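{- Let $q$ be a prime power with $q\equiv 1\pmod 8$, and let $\alpha$ be a primitive element of $\mathbb{F}_q$. Let $\gamma\in C_2^4$, let $R$ be a set of representatives for the quotient group $C_0^4/\{1,-1\}$, and for $i\in R$ define $D_i=\{i,-i,\gamma i,-\gamma i\}$. Let $\mathcal{D}=\{D_i:i\in R\}$. If one of $1-\gamma$ and $1+\gamma$ lies in $C_0^4$ while the other lies in $C_2^4$, then $\mathcal{D}$ is a $(q,(q-1)/8,4;(q-17)/4,(q-1)/4)$-EPDF and a $(q,(q-1)/8,4;3,0)$-DPDF.
   Context: For $e\mid q-1$, $C_i^e=\alpha^i\langle\alpha^e\rangle$, indices mod $e$. $G=(\mathbb{F}_q,+)$, $G^*=\mathbb{F}_q^*$. $\Delta(D)=\{x-y:x\neq y\in D\}$ and $\Delta(D_1,D_2)=\{x-y:x\in D_1,y\in D_2\}$ (multisets). For a collection $\mathcal{D}$ of $m$ pairwise disjoint $k$-subsets $D_1,\ldots,D_m$ of $G^*$ ($n=|G|$), with $S=\bigcup_iD_i$: it is an $(n,m,k;\lambda,\mu)$-DPDF if $\sum_i\Delta(D_i)=\lambda S+\mu(G^*\setminus S)$, and an $(n,m,k;\lambda,\mu)$-EPDF if $\sum_{i\neq j}\Delta(D_i,D_j)=\lambda S+\mu(G^*\setminus S)$. -}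

module Defs where

open import Level using (0ℓ)
open import Data.Nat as ℕ using (ℕ; zero; suc; _≥_)
open import Data.Nat.Primality using (Prime)
open import Data.Integer as ℤ using (ℤ)
open import Data.Fin using (Fin)
open import Data.Fin.Properties using () renaming (_≟_ to _≟ᶠ_)
open import Data.List using (List; []; _∷_; length; map; lookup; concat; allFin)
open import Data.Nat.ListAction using (sum)
open import Data.List.Membership.Propositional using (_∈_; _∉_)
open import Data.List.Relation.Unary.Unique.Propositional using (Unique)
open import Data.List.Relation.Unary.All using (All)
open import Data.Product using (Σ; ∃; _×_; _,_)
open import Data.Sum using (_⊎_)
open import Relation.Binary.PropositionalEquality using (_≡_; _≢_)
open import Relation.Binary.Definitions using (DecidableEquality)
open import Relation.Nullary using (yes; no; ¬_)
import Algebra.Structures as AS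

record FiniteField : Set₁ where
  infixl 6 _+_ _-_
  infixl 7 _*_
  field
    Carrier : Set
    _+_ _*_ : Carrier → Carrier → Carrier
    -_      : Carrier → Carrier
    0# 1#   : Carrier
    isCommutativeRing : AS.IsCommutativeRing _≡_ _+_ _*_ -_ 0# 1#
    0≢1     : 0# ≢ 1#
    inverse : ∀ x → x ≢ 0# → ∃ λ y → x * y ≡ 1#
    _≟_     : DecidableEquality Carrier
    elements : List Carrier
    complete : ∀ x → x ∈ elements
    unique   : Unique elements

  _-_ : Carrier → Carrier → Carrier
  x - y = x + (- y)

  size : ℕ
  size = length elements

  _^_ : Carrier → ℕ → Carrier
  x ^ zero  = 1#
  x ^ suc n = x * (x ^ n)

  IsPrimitive : Carrier → Set
  IsPrimitive α = α ≢ 0# × (∀ x → x ≢ 0# → ∃ λ k → α ^ k ≡ x)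

  -- x ∈ C_i^e = α^i ⟨α^e⟩  (for a given primitive element α)
  InC : (α : Carrier) (e i : ℕ) → Carrier → Set
  InC α e i x = ∃ λ j → x ≡ α ^ (e ℕ.* j ℕ.+ i)

  IsRepSystem : (α : Carrier) → List Carrier → Set
  IsRepSystem α R =
      All (InC α 4 0) R
    × (∀ x → InC α 4 0 x → ∃ λ r → r ∈ R × (x ≡ r ⊎ x ≡ - r))
    × (∀ (i j : Fin (length R)) →
         (lookup R i ≡ lookup R j ⊎ lookup R i ≡ - lookup R j) → i ≡ j)

  δ : Carrier → Carrier → ℕ
  δ a b with a ≟ b
  ... | yes _ = 1
  ... | no  _ = 0

  δ≢ : Carrier → Carrier → ℕ
  δ≢ a b with a ≟ b
  ... | yes _ = 0
  ... | no  _ = 1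

  -- multiplicity of g in the multiset Δ(A) = {x - y : x ≠ y ∈ A}
  multΔ : List Carrier → Carrier → ℕ
  multΔ A g = sum (map (λ x → sum (map (λ y → δ≢ x y ℕ.* δ (x - y) g) A)) A)

  -- multiplicity of g in the multiset Δ(A,B) = {x - y : x ∈ A, y ∈ B}
  multΔ₂ : List Carrier → List Carrier → Carrier → ℕ
  multΔ₂ A B g = sum (map (λ x → sum (map (λ y → δ (x - y) g) B)) A)

  δFin≢ : ∀ {m} → Fin m → Fin m → ℕ
  δFin≢ i j with i ≟ᶠ j
  ... | yes _ = 0
  ... | no  _ = 1

  multDPDF : List (List Carrier) → Carrier → ℕ
  multDPDF 𝒟 g = sum (map (λ D → multΔ D g) 𝒟)

  -- multiplicity of g in Σ_{i ≠ j} Δ(D_i, D_j)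
  multEPDF : List (List Carrier) → Carrier → ℕ
  multEPDF 𝒟 g =
    sum (map (λ i → sum (map (λ j → δFin≢ i j ℕ.* multΔ₂ (lookup 𝒟 i) (lookup 𝒟 j) g)
                             (allFin (length 𝒟))))
             (allFin (length 𝒟)))

  IsCollection : (n m k : ℕ) → List (List Carrier) → Set
  IsCollection n m k 𝒟 =
      n ≡ size
    × length 𝒟 ≡ m
    × All (λ D → Unique D × length D ≡ k × All (λ x → x ≢ 0#) D) 𝒟
    × (∀ (i j : Fin (length 𝒟)) → i ≢ j → ∀ x → x ∈ lookup 𝒟 i → x ∉ lookup 𝒟 j)

  -- a multiset on G with multiplicity function mult equals λ S + μ (G^* \ S)
  -- (S = ⋃ D_i)
  EqualsλSμ : (mult : Carrier → ℕ) (λ' μ : ℤ) → List (List Carrier) → Set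
  EqualsλSμ mult λ' μ 𝒟 =
    ∀ g → (g ≡ 0# → mult g ≡ 0)
        × (g ≢ 0# → g ∈ concat 𝒟 → ℤ.+ mult g ≡ λ')
        × (g ≢ 0# → g ∉ concat 𝒟 → ℤ.+ mult g ≡ μ)

  IsDPDF : (n m k : ℕ) (λ' μ : ℤ) → List (List Carrier) → Set
  IsDPDF n m k λ' μ 𝒟 = IsCollection n m k 𝒟 × EqualsλSμ (multDPDF 𝒟) λ' μ 𝒟

  IsEPDF : (n m k : ℕ) (λ' μ : ℤ) → List (List Carrier) → Set
  IsEPDF n m k λ' μ 𝒟 = IsCollection n m k 𝒟 × EqualsλSμ (multEPDF 𝒟) λ' μ 𝒟

  blockD : Carrier → Carrier → List Carrier
  blockD γ i = i ∷ (- i) ∷ (γ * i) ∷ (- (γ * i)) ∷ []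

IsPrimePower : ℕ → Set
IsPrimePower q = ∃ λ p → ∃ λ k → Prime p × k ≥ 1 × q ≡ p ℕ.^ k

module Submission where

-- The blocks D_r = {±r, ±γr}, r ∈ R, partition S = C₀⁴ ∪ C₂⁴, the set of nonzero squares.  The
-- differences inside D_r are ±2r, ±2γr and, twice each, ±(1−γ)r and ±(1+γ)r.  Since −1 ∈ C₀⁴, the
-- elements ±cr (r ∈ R) run exactly once through the class of c; so a pair {c, c′} with one element
-- in C₀⁴ and the other in C₂⁴ contributes every element of S once and nothing else.  This applies to
-- {1, γ}, to {2, 2γ} (2 is a square as q ≡ 1 mod 8) and, by hypothesis, to {1−γ, 1+γ}, whence
-- Σ_r Δ(D_r) = 3S.  The external differences are Δ(S, S) − Σ_r Δ(D_r), and Δ(S, S)(g) for g ≠ 0 comes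
-- from counting the q − 1 solutions of a² − b² = g: those with ab ≠ 0 number 4·Δ(S, S)(g) and the
-- others 4·[g ∈ S], because every nonzero square has exactly two square roots.

open import Defs

module Lists where
  open import Data.Nat using (ℕ; suc; z≤n; _+_; _*_; _≤_)
  open import Data.Nat.Properties
    using (+-identityʳ; *-zeroʳ; *-comm; *-distribˡ-+; +-mono-≤; m≤m+n; m≤n+m; ≤-trans; +-commutativeSemigroup)
  open import Data.Nat.ListAction using (sum)
  open import Data.Nat.ListAction.Properties using (sum-++)
  open import Data.Fin as Fin using (Fin; cast)
  import Data.Fin.Properties as Fin
  open import Data.List using (List; []; _∷_; _++_; map; concat; length; lookup; allFin; tabulate)
  open import Data.List.Properties using (length-map; map-++; map-tabulate; tabulate-lookup)
  open import Data.List.Membership.Propositional using (_∈_)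
  open import Data.List.Relation.Unary.Any using (here; there; index)
  open import Data.List.Relation.Unary.Any.Properties using (lookup-index)
  open import Algebra.Properties.CommutativeSemigroup +-commutativeSemigroup using (interchange)
  open import Function using (_∘_; id)
  open import Relation.Binary.PropositionalEquality

  private
    variable
      A B : Set

  ∑ : List A → (A → ℕ) → ℕ
  ∑ xs f = sum (map f xs)

  ∑-cong-∈ : ∀ xs {f g : A → ℕ} → (∀ {x} → x ∈ xs → f x ≡ g x) → ∑ xs f ≡ ∑ xs g
  ∑-cong-∈ []       f≗g = refl
  ∑-cong-∈ (x ∷ xs) f≗g = cong₂ _+_ (f≗g (here refl)) (∑-cong-∈ xs (f≗g ∘ there))

  ∑-cong : ∀ xs {f g : A → ℕ} → (∀ x → f x ≡ g x) → ∑ xs f ≡ ∑ xs g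
  ∑-cong xs f≗g = ∑-cong-∈ xs (λ {x} _ → f≗g x)

  ∑-zero-∈ : ∀ xs {f : A → ℕ} → (∀ {x} → x ∈ xs → f x ≡ 0) → ∑ xs f ≡ 0
  ∑-zero-∈ []       f≗0 = refl
  ∑-zero-∈ (x ∷ xs) f≗0 = cong₂ _+_ (f≗0 (here refl)) (∑-zero-∈ xs (f≗0 ∘ there))

  ∑-zero : ∀ xs {f : A → ℕ} → (∀ x → f x ≡ 0) → ∑ xs f ≡ 0
  ∑-zero xs f≗0 = ∑-zero-∈ xs (λ {x} _ → f≗0 x)

  ∑-const : ∀ (xs : List A) c → ∑ xs (λ _ → c) ≡ length xs * c
  ∑-const []       c = refl
  ∑-const (x ∷ xs) c = cong (c +_) (∑-const xs c)

  ∑-distrib-+ : ∀ xs (f g : A → ℕ) → ∑ xs (λ x → f x + g x) ≡ ∑ xs f + ∑ xs g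
  ∑-distrib-+ []       f g = refl
  ∑-distrib-+ (x ∷ xs) f g = begin
    f x + g x + ∑ xs (λ x → f x + g x) ≡⟨ cong (f x + g x +_) (∑-distrib-+ xs f g) ⟩
    f x + g x + (∑ xs f + ∑ xs g)      ≡⟨ interchange (f x) (g x) (∑ xs f) (∑ xs g) ⟩
    f x + ∑ xs f + (g x + ∑ xs g)      ∎
    where open ≡-Reasoning

  ∑-*ˡ : ∀ xs c (f : A → ℕ) → ∑ xs (λ x → c * f x) ≡ c * ∑ xs f
  ∑-*ˡ []       c f = sym (*-zeroʳ c)
  ∑-*ˡ (x ∷ xs) c f = trans (cong (c * f x +_) (∑-*ˡ xs c f)) (sym (*-distribˡ-+ c (f x) (∑ xs f)))

  ∑-*ʳ : ∀ xs c (f : A → ℕ) → ∑ xs (λ x → f x * c) ≡ ∑ xs f * c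
  ∑-*ʳ xs c f = begin
    ∑ xs (λ x → f x * c) ≡⟨ ∑-cong xs (λ x → *-comm (f x) c) ⟩
    ∑ xs (λ x → c * f x) ≡⟨ ∑-*ˡ xs c f ⟩
    c * ∑ xs f           ≡⟨ *-comm c (∑ xs f) ⟩
    ∑ xs f * c           ∎
    where open ≡-Reasoning

  ∑-mono-≤ : ∀ xs {f g : A → ℕ} → (∀ x → f x ≤ g x) → ∑ xs f ≤ ∑ xs g
  ∑-mono-≤ []       f≤g = z≤n
  ∑-mono-≤ (x ∷ xs) f≤g = +-mono-≤ (f≤g x) (∑-mono-≤ xs f≤g)

  ∈⇒≤∑ : ∀ {xs x} (f : A → ℕ) → x ∈ xs → f x ≤ ∑ xs f
  ∈⇒≤∑ {xs = _ ∷ xs} f (here refl) = m≤m+n _ (∑ xs f)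
  ∈⇒≤∑ {xs = y ∷ xs} f (there x∈) = ≤-trans (∈⇒≤∑ f x∈) (m≤n+m _ (f y))

  ∑-lookup : ∀ (xs : List A) (f : A → ℕ) → ∑ (allFin (length xs)) (f ∘ lookup xs) ≡ ∑ xs f
  ∑-lookup xs f = begin
    sum (map (f ∘ lookup xs) (tabulate id)) ≡⟨ cong sum (map-tabulate id (f ∘ lookup xs)) ⟩
    sum (tabulate (f ∘ lookup xs))          ≡⟨ cong sum (sym (map-tabulate (lookup xs) f)) ⟩
    sum (map f (tabulate (lookup xs)))      ≡⟨ cong (sum ∘ map f) (tabulate-lookup xs) ⟩
    ∑ xs f                                  ∎
    where open ≡-Reasoning

  ∑-map : ∀ (h : A → B) xs (f : B → ℕ) → ∑ (map h xs) f ≡ ∑ xs (f ∘ h)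
  ∑-map h []       f = refl
  ∑-map h (x ∷ xs) f = cong (f (h x) +_) (∑-map h xs f)

  ∑-comm : ∀ xs ys (f : A → B → ℕ) → ∑ xs (λ x → ∑ ys (f x)) ≡ ∑ ys (λ y → ∑ xs (λ x → f x y))
  ∑-comm []       ys f = sym (∑-zero ys (λ _ → refl))
  ∑-comm (x ∷ xs) ys f = begin
    ∑ ys (f x) + ∑ xs (λ x → ∑ ys (f x))       ≡⟨ cong (∑ ys (f x) +_) (∑-comm xs ys f) ⟩
    ∑ ys (f x) + ∑ ys (λ y → ∑ xs (λ x → f x y)) ≡⟨ ∑-distrib-+ ys (f x) _ ⟨
    ∑ ys (λ y → f x y + ∑ xs (λ x → f x y))    ∎
    where open ≡-Reasoning

  ∑-concat : ∀ (xss : List (List A)) (f : A → ℕ) → ∑ (concat xss) f ≡ ∑ xss (λ xs → ∑ xs f)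
  ∑-concat []         f = refl
  ∑-concat (xs ∷ xss) f = begin
    sum (map f (xs ++ concat xss))        ≡⟨ cong sum (map-++ f xs (concat xss)) ⟩
    sum (map f xs ++ map f (concat xss))  ≡⟨ sum-++ (map f xs) _ ⟩
    ∑ xs f + ∑ (concat xss) f ≡⟨ cong (∑ xs f +_) (∑-concat xss f) ⟩
    ∑ xs f + ∑ xss (λ xs → ∑ xs f) ∎
    where open ≡-Reasoning

  ∑-allFin-suc : ∀ m (f : Fin (suc m) → ℕ) → ∑ (allFin (suc m)) f ≡ f Fin.zero + ∑ (allFin m) (f ∘ Fin.suc)
  ∑-allFin-suc m f = cong (f Fin.zero +_) (begin
    sum (map f (tabulate Fin.suc))    ≡⟨ cong sum (map-tabulate Fin.suc f) ⟩
    sum (tabulate (f ∘ Fin.suc))      ≡⟨ cong sum (map-tabulate id (f ∘ Fin.suc)) ⟨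
    ∑ (allFin m) (f ∘ Fin.suc)        ∎)
    where open ≡-Reasoning

  ∑-lookup-single : ∀ (xs : List A) (f : A → ℕ) i → (∀ j → j ≢ i → f (lookup xs j) ≡ 0) → ∑ xs f ≡ f (lookup xs i)
  ∑-lookup-single (x ∷ xs) f Fin.zero    others = begin
    f x + ∑ xs f  ≡⟨ cong (f x +_) (∑-zero-∈ xs (λ y∈xs → subst (λ y → f y ≡ 0) (sym (lookup-index y∈xs))
                                                         (others (Fin.suc (index y∈xs)) λ ()))) ⟩
    f x + 0       ≡⟨ +-identityʳ (f x) ⟩
    f x           ∎
    where open ≡-Reasoning
  ∑-lookup-single (x ∷ xs) f (Fin.suc i) others =
    trans (cong (_+ ∑ xs f) (others Fin.zero λ ()))
          (∑-lookup-single xs f i (λ j j≢i → others (Fin.suc j) (j≢i ∘ Fin.suc-injective)))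

  lookup-map : ∀ (h : A → B) xs i → lookup (map h xs) i ≡ h (lookup xs (cast (length-map h xs) i))
  lookup-map h (x ∷ xs) Fin.zero    = refl
  lookup-map h (x ∷ xs) (Fin.suc i) = lookup-map h xs i

open Lists

module IntegerDivision where
  open import Data.Nat as ℕ using (ℕ; _+_; _*_; _∸_; NonZero)
  import Data.Nat.Properties as ℕ
  open import Data.Nat.DivMod using (m*n/n≡m)
  open import Data.Integer using (+_; _-_; _/ℕ_)
  open import Data.Integer.Properties using ([+m]-[+n]≡m⊖n; ⊖-≥)
  open import Relation.Binary.PropositionalEquality

  [m-c]/d≡e : ∀ {m c d e} .{{_ : NonZero d}} → m ≡ e * d + c → (+ m - + c) /ℕ d ≡ + e
  [m-c]/d≡e {c = c} {d} {e} refl = begin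
    (+ (e * d + c) - + c) /ℕ d   ≡⟨ cong (_/ℕ d) (trans ([+m]-[+n]≡m⊖n (e * d + c) c) (⊖-≥ (ℕ.m≤n+m c (e * d)))) ⟩
    + ((e * d + c ∸ c) ℕ./ d)     ≡⟨ cong (λ k → + (k ℕ./ d)) (ℕ.m+n∸n≡m (e * d) c) ⟩
    + (e * d ℕ./ d)               ≡⟨ cong +_ (m*n/n≡m e d) ⟩
    + e                           ∎
    where open ≡-Reasoning

open IntegerDivision

module FieldTheory (F : FiniteField) where
  open FiniteField F
  open import Level using (0ℓ)
  open import Algebra.Bundles using (CommutativeRing)
  open import Data.Nat as ℕ using (ℕ; zero; suc; z≤n; s≤s; _∸_; _/_; _%_; NonZero)
    renaming (_+_ to _+ℕ_; _*_ to _*ℕ_; _≤_ to _≤ℕ_)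
  import Data.Nat.Properties as ℕ
  open import Data.Empty using (⊥; ⊥-elim)
  open import Data.Product using (_×_; _,_; proj₁; proj₂; ∃)
  open import Data.Sum using (_⊎_; inj₁; inj₂; [_,_]′)
  open import Relation.Nullary using (Dec; yes; no; ¬_)
  open import Function using (_∘_; case_of_; flip)
  open import Data.List using (List; []; _∷_; map; concat; length; lookup; allFin; tabulate)
  open import Data.List.Properties using (length-map; length-tabulate)
  open import Data.List.Membership.Propositional.Properties using (∈-tabulate⁺; ∈-lookup; ∈-map⁻; ∈-concat⁻′)
  import Data.List.Relation.Unary.All.Properties as AllP
  import Data.List.Relation.Unary.Unique.Propositional.Properties as UniqueP
  open import Data.Fin as Fin using (Fin; toℕ; fromℕ<)
  open import Data.Fin.Properties using (any?; toℕ<n; toℕ-fromℕ<; <-cmp) renaming (_≟_ to _≟ᶠ_)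
  import Data.Fin.Properties as Fin
  open import Data.Nat.DivMod using (m≡m%n+[m/n]*n; m%n<n; %-remove-+ʳ; [m+kn]%n≡m%n; m<n⇒m%n≡m; m*n/n≡m)
  import Data.Integer as ℤ
  open import Data.Nat.Divisibility using (_∣_; divides; m%n≡0⇒n∣m; ∣-trans)
  open import Data.Nat.Tactic.RingSolver using (solve-∀)
  open import Relation.Binary.Definitions using (tri<; tri≈; tri>)
  open import Data.List.Membership.Propositional using (_∈_; _∉_)
  open import Data.List.Relation.Unary.Any using (here; there; index)
  open import Data.List.Relation.Unary.Any.Properties using (lookup-index)
  import Data.List.Relation.Unary.All as All
  open All using ([]; _∷_)
  open import Data.List.Relation.Unary.AllPairs using ([]; _∷_)
  open import Data.List.Relation.Unary.Unique.Propositional using (Unique)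
  open import Relation.Binary.PropositionalEquality
  open ≡-Reasoning

  commutativeRing : CommutativeRing 0ℓ 0ℓ
  commutativeRing = record { isCommutativeRing = isCommutativeRing }

  open CommutativeRing commutativeRing
    using (+-assoc; +-comm; +-identityˡ; +-identityʳ; -‿inverseʳ;
           *-assoc; *-comm; *-identityˡ; *-identityʳ; distribˡ; distribʳ; zeroˡ; zeroʳ)
  open import Algebra.Properties.Ring (CommutativeRing.ring commutativeRing)
    using (-‿involutive; -‿injective; -‿distribˡ-*; -‿distribʳ-*; -‿+-comm; -0#≈0#;
           +-inverseʳ-unique; x∙y⁻¹≈ε⇒x≈y; ⁻¹-anti-homo‿-; -1*x≈-x; +-cancelʳ)

  open import Algebra.Properties.CommutativeSemigroup (CommutativeRing.+-commutativeSemigroup commutativeRing)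
    using () renaming (interchange to +-interchange)
  open import Algebra.Properties.CommutativeSemigroup (CommutativeRing.*-commutativeSemigroup commutativeRing)
    using () renaming (interchange to *-interchange)

  2# : Carrier
  2# = 1# + 1#

  x+x≡2x : ∀ x → x + x ≡ 2# * x
  x+x≡2x x = sym (trans (distribʳ x 1# 1#) (cong₂ _+_ (*-identityˡ x) (*-identityˡ x)))

  x*y≡0⇒y≡0 : ∀ {x y} → x ≢ 0# → x * y ≡ 0# → y ≡ 0#
  x*y≡0⇒y≡0 {x} {y} x≢0 xy≡0 with inverse x x≢0
  ... | x⁻¹ , xx⁻¹≡1 = begin
    y              ≡⟨ *-identityˡ y ⟨
    1# * y         ≡⟨ cong (_* y) (trans (sym xx⁻¹≡1) (*-comm x x⁻¹)) ⟩
    x⁻¹ * x * y    ≡⟨ *-assoc x⁻¹ x y ⟩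
    x⁻¹ * (x * y)  ≡⟨ cong (x⁻¹ *_) xy≡0 ⟩
    x⁻¹ * 0#       ≡⟨ zeroʳ x⁻¹ ⟩
    0#             ∎

  *-nonzero : ∀ {x y} → x ≢ 0# → y ≢ 0# → x * y ≢ 0#
  *-nonzero x≢0 y≢0 xy≡0 = y≢0 (x*y≡0⇒y≡0 x≢0 xy≡0)

  *-cancelˡ : ∀ {c x y} → c ≢ 0# → c * x ≡ c * y → x ≡ y
  *-cancelˡ {c} {x} {y} c≢0 cx≡cy = x∙y⁻¹≈ε⇒x≈y x y (x*y≡0⇒y≡0 c≢0 (begin
    c * (x - y)      ≡⟨ distribˡ c x (- y) ⟩
    c * x + c * - y  ≡⟨ cong₂ _+_ cx≡cy (sym (-‿distribʳ-* c y)) ⟩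
    c * y - c * y    ≡⟨ -‿inverseʳ (c * y) ⟩
    0#               ∎))

  infix 4 _≡±_
  _≡±_ : Carrier → Carrier → Set
  x ≡± y = x ≡ y ⊎ x ≡ - y

  ≡±-sym : ∀ {x y} → x ≡± y → y ≡± x
  ≡±-sym (inj₁ x≡y)  = inj₁ (sym x≡y)
  ≡±-sym (inj₂ x≡-y) = inj₂ (trans (sym (-‿involutive _)) (cong -_ (sym x≡-y)))

  ≡±-trans : ∀ {x y z} → x ≡± y → y ≡± z → x ≡± z
  ≡±-trans (inj₁ x≡y)  (inj₁ y≡z)  = inj₁ (trans x≡y y≡z)
  ≡±-trans (inj₁ x≡y)  (inj₂ y≡-z) = inj₂ (trans x≡y y≡-z)
  ≡±-trans (inj₂ x≡-y) (inj₁ y≡z)  = inj₂ (trans x≡-y (cong -_ y≡z))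
  ≡±-trans (inj₂ x≡-y) (inj₂ y≡-z) = inj₁ (trans x≡-y (trans (cong -_ y≡-z) (-‿involutive _)))

  *-congˡ-≡± : ∀ c {x y} → x ≡± y → c * x ≡± c * y
  *-congˡ-≡± c (inj₁ x≡y)  = inj₁ (cong (c *_) x≡y)
  *-congˡ-≡± c {y = y} (inj₂ x≡-y) = inj₂ (trans (cong (c *_) x≡-y) (sym (-‿distribʳ-* c y)))

  *-cancelˡ-≡± : ∀ {c x y} → c ≢ 0# → c * x ≡± c * y → x ≡± y
  *-cancelˡ-≡± c≢0 (inj₁ cx≡cy)  = inj₁ (*-cancelˡ c≢0 cx≡cy)
  *-cancelˡ-≡± {c} {y = y} c≢0 (inj₂ cx≡-cy) = inj₂ (*-cancelˡ c≢0 (trans cx≡-cy (-‿distribʳ-* c y)))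

  ≡±⇒x²≡y² : ∀ {x y} → x ≡± y → x * x ≡ y * y
  ≡±⇒x²≡y² (inj₁ refl) = refl
  ≡±⇒x²≡y² {y = y} (inj₂ refl) = begin
    - y * - y      ≡⟨ -‿distribˡ-* y (- y) ⟨
    - (y * - y)    ≡⟨ cong -_ (-‿distribʳ-* y y) ⟨
    - - (y * y)    ≡⟨ -‿involutive (y * y) ⟩
    y * y          ∎

  [x-y][x+y]≡x²-y² : ∀ x y → (x - y) * (x + y) ≡ x * x - y * y
  [x-y][x+y]≡x²-y² x y = begin
    (x - y) * (x + y)                            ≡⟨ distribʳ (x + y) x (- y) ⟩
    x * (x + y) + - y * (x + y)                  ≡⟨ cong₂ _+_ (distribˡ x x y) (distribˡ (- y) x y) ⟩
    (x * x + x * y) + (- y * x + - y * y)        ≡⟨ cong₂ (λ a b → (x * x + x * y) + (a + b)) -yx≡-xy (sym (-‿distribˡ-* y y)) ⟩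
    (x * x + x * y) + (- (x * y) + - (y * y))    ≡⟨ +-assoc (x * x) (x * y) _ ⟩
    x * x + (x * y + (- (x * y) + - (y * y)))    ≡⟨ cong (x * x +_) (+-assoc (x * y) (- (x * y)) _) ⟨
    x * x + ((x * y - x * y) + - (y * y))        ≡⟨ cong (λ a → x * x + (a + - (y * y))) (-‿inverseʳ (x * y)) ⟩
    x * x + (0# + - (y * y))                     ≡⟨ cong (x * x +_) (+-identityˡ _) ⟩
    x * x - y * y                                ∎
    where
    -yx≡-xy : - y * x ≡ - (x * y)
    -yx≡-xy = trans (sym (-‿distribˡ-* y x)) (cong -_ (*-comm y x))

  square-roots : ∀ {x y} → x * x ≡ y * y → x ≡± y
  square-roots {x} {y} x²≡y² with (x - y) ≟ 0#
  ... | yes x-y≡0 = inj₁ (x∙y⁻¹≈ε⇒x≈y x y x-y≡0)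
  ... | no  x-y≢0 = inj₂ (+-inverseʳ-unique y x (trans (+-comm y x) x+y≡0))
    where
    x+y≡0 : x + y ≡ 0#
    x+y≡0 = x*y≡0⇒y≡0 x-y≢0 (begin
      (x - y) * (x + y)  ≡⟨ [x-y][x+y]≡x²-y² x y ⟩
      x * x - y * y      ≡⟨ cong (_- y * y) x²≡y² ⟩
      y * y - y * y      ≡⟨ -‿inverseʳ (y * y) ⟩
      0#                 ∎)

  x≢-x : 2# ≢ 0# → ∀ {x} → x ≢ 0# → x ≢ - x
  x≢-x 2≢0 {x} x≢0 x≡-x = x≢0 (x*y≡0⇒y≡0 2≢0 (begin
    2# * x  ≡⟨ x+x≡2x x ⟨
    x + x   ≡⟨ cong (x +_) x≡-x ⟩
    x - x   ≡⟨ -‿inverseʳ x ⟩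
    0#      ∎))

  δ-≡ : ∀ {a b} → a ≡ b → δ a b ≡ 1
  δ-≡ {a} {b} a≡b with a ≟ b
  ... | yes _   = refl
  ... | no  a≢b = ⊥-elim (a≢b a≡b)

  δ-≢ : ∀ {a b} → a ≢ b → δ a b ≡ 0
  δ-≢ {a} {b} a≢b with a ≟ b
  ... | yes a≡b = ⊥-elim (a≢b a≡b)
  ... | no  _   = refl

  δ-cong : ∀ {a b c d} → (a ≡ b → c ≡ d) → (c ≡ d → a ≡ b) → δ a b ≡ δ c d
  δ-cong {a} {b} a≡b⇒c≡d c≡d⇒a≡b with a ≟ b
  ... | yes a≡b = sym (δ-≡ (a≡b⇒c≡d a≡b))
  ... | no  a≢b = sym (δ-≢ (a≢b ∘ c≡d⇒a≡b))

  δ-sym : ∀ a b → δ a b ≡ δ b a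
  δ-sym a b = δ-cong sym sym

  δ+δ≢≡1 : ∀ a b → δ a b +ℕ δ≢ a b ≡ 1
  δ+δ≢≡1 a b with a ≟ b
  ... | yes _ = refl
  ... | no  _ = refl

  ±δ : Carrier → Carrier → ℕ
  ±δ x g = δ x g +ℕ δ (- x) g

  ±δ-≡± : 2# ≢ 0# → ∀ {x g} → g ≢ 0# → x ≡± g → ±δ x g ≡ 1
  ±δ-≡± 2≢0 {x} {g} g≢0 (inj₁ x≡g)  =
    cong₂ _+ℕ_ (δ-≡ x≡g) (δ-≢ (λ -x≡g → x≢-x 2≢0 g≢0 (sym (trans (cong -_ (sym x≡g)) -x≡g))))
  ±δ-≡± 2≢0 {x} {g} g≢0 (inj₂ x≡-g) =
    cong₂ _+ℕ_ (δ-≢ (λ x≡g → x≢-x 2≢0 g≢0 (trans (sym x≡g) x≡-g))) (δ-≡ (trans (cong -_ x≡-g) (-‿involutive g)))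

  ±δ-≢± : ∀ {x g} → ¬ (x ≡± g) → ±δ x g ≡ 0
  ±δ-≢± {x} {g} x≢±g =
    cong₂ _+ℕ_ (δ-≢ (x≢±g ∘ inj₁)) (δ-≢ (λ -x≡g → x≢±g (inj₂ (trans (sym (-‿involutive x)) (cong -_ -x≡g)))))

  ∑-select-∈ : ∀ {xs x} (f : Carrier → ℕ) → Unique xs → x ∈ xs → ∑ xs (λ y → δ x y *ℕ f y) ≡ f x
  ∑-select-∈ {y ∷ ys} f (y∉ys ∷ _) (here refl) = begin
    δ y y *ℕ f y +ℕ ∑ ys (λ z → δ y z *ℕ f z)  ≡⟨ cong₂ (λ a b → a *ℕ f y +ℕ b) (δ-≡ refl) rest≡0 ⟩
    1 *ℕ f y +ℕ 0                              ≡⟨ ℕ.+-identityʳ _ ⟩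
    1 *ℕ f y                                   ≡⟨ ℕ.*-identityˡ (f y) ⟩
    f y                                        ∎
    where
    rest≡0 : ∑ ys (λ z → δ y z *ℕ f z) ≡ 0
    rest≡0 = ∑-zero-∈ ys (λ z∈ys → cong (_*ℕ _) (δ-≢ (All.lookup y∉ys z∈ys)))
  ∑-select-∈ {y ∷ ys} {x} f (y∉ys ∷ uniq) (there x∈ys) = begin
    δ x y *ℕ f y +ℕ ∑ ys (λ z → δ x z *ℕ f z)  ≡⟨ cong (λ a → a *ℕ f y +ℕ _) (δ-≢ (λ x≡y → All.lookup y∉ys x∈ys (sym x≡y))) ⟩
    ∑ ys (λ z → δ x z *ℕ f z)                  ≡⟨ ∑-select-∈ f uniq x∈ys ⟩
    f x                                        ∎

  ∑-select : ∀ x (f : Carrier → ℕ) → ∑ elements (λ y → δ x y *ℕ f y) ≡ f x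
  ∑-select x f = ∑-select-∈ f unique (complete x)

  ∑-select′ : ∀ x (f : Carrier → ℕ) → ∑ elements (λ y → δ y x *ℕ f y) ≡ f x
  ∑-select′ x f = trans (∑-cong elements (λ y → cong (_*ℕ f y) (δ-sym y x))) (∑-select x f)

  ∑-δ≡1 : ∀ c → ∑ elements (λ x → δ x c) ≡ 1
  ∑-δ≡1 c = begin
    ∑ elements (λ x → δ x c)         ≡⟨ ∑-cong elements (λ x → trans (δ-sym x c) (sym (ℕ.*-identityʳ _))) ⟩
    ∑ elements (λ x → δ c x *ℕ 1)    ≡⟨ ∑-select c (λ _ → 1) ⟩
    1                                ∎

  multiplicity : List Carrier → Carrier → ℕ
  multiplicity xs y = ∑ xs (λ z → δ z y)

  multiplicity-∈ : ∀ {xs y} → y ∈ xs → 1 ≤ℕ multiplicity xs y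
  multiplicity-∈ {xs} {y} y∈xs = subst (_≤ℕ multiplicity xs y) (δ-≡ refl) (∈⇒≤∑ (λ z → δ z y) y∈xs)

  multiplicity-∉ : ∀ {xs y} → y ∉ xs → multiplicity xs y ≡ 0
  multiplicity-∉ {xs} y∉xs = ∑-zero-∈ xs (λ z∈xs → δ-≢ (λ { refl → y∉xs z∈xs }))

  multiplicity-Unique : ∀ {xs} y → Unique xs → multiplicity xs y ≤ℕ 1
  multiplicity-Unique {[]}     y _ = z≤n
  multiplicity-Unique {z ∷ zs} y (z∉zs ∷ uniq) with z ≟ y
  ... | yes refl = s≤s (ℕ.≤-reflexive (multiplicity-∉ (λ z∈zs → All.lookup z∉zs z∈zs refl)))
  ... | no  _    = multiplicity-Unique y uniq

  ∑-via-multiplicity : ∀ xs (f : Carrier → ℕ) → ∑ xs f ≡ ∑ elements (λ y → multiplicity xs y *ℕ f y)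
  ∑-via-multiplicity []       f = sym (∑-zero elements (λ _ → refl))
  ∑-via-multiplicity (x ∷ xs) f = begin
    f x +ℕ ∑ xs f
      ≡⟨ cong₂ _+ℕ_ (sym (∑-select x f)) (∑-via-multiplicity xs f) ⟩
    ∑ elements (λ y → δ x y *ℕ f y) +ℕ ∑ elements (λ y → multiplicity xs y *ℕ f y)
      ≡⟨ ∑-distrib-+ elements _ _ ⟨
    ∑ elements (λ y → δ x y *ℕ f y +ℕ multiplicity xs y *ℕ f y)
      ≡⟨ ∑-cong elements (λ y → ℕ.*-distribʳ-+ (f y) (δ x y) (multiplicity xs y)) ⟨
    ∑ elements (λ y → multiplicity (x ∷ xs) y *ℕ f y) ∎

  ∑-reindex : ∀ (φ ψ : Carrier → Carrier) → (∀ x → ψ (φ x) ≡ x) → (∀ y → φ (ψ y) ≡ y) →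
              ∀ (h : Carrier → ℕ) → ∑ elements (h ∘ φ) ≡ ∑ elements h
  ∑-reindex φ ψ ψφ≗id φψ≗id h = begin
    ∑ elements (h ∘ φ)                                        ≡⟨ ∑-map φ elements h ⟨
    ∑ (map φ elements) h                                      ≡⟨ ∑-via-multiplicity (map φ elements) h ⟩
    ∑ elements (λ y → multiplicity (map φ elements) y *ℕ h y) ≡⟨ ∑-cong elements (λ y → cong (_*ℕ h y) (fibre≡1 y)) ⟩
    ∑ elements (λ y → 1 *ℕ h y)                               ≡⟨ ∑-cong elements (λ y → ℕ.*-identityˡ (h y)) ⟩
    ∑ elements h                                              ∎
    where
    fibre≡1 : ∀ y → multiplicity (map φ elements) y ≡ 1
    fibre≡1 y = begin
      multiplicity (map φ elements) y  ≡⟨ ∑-map φ elements (λ z → δ z y) ⟩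
      ∑ elements (λ x → δ (φ x) y)     ≡⟨ ∑-cong elements (λ x → δ-cong (λ φx≡y → trans (sym (ψφ≗id x)) (cong ψ φx≡y))
                                                                        (λ x≡ψy → trans (cong φ x≡ψy) (φψ≗id y))) ⟩
      ∑ elements (λ x → δ x (ψ y))     ≡⟨ ∑-δ≡1 (ψ y) ⟩
      1                                ∎

  ∑-pushforward : ∀ (w : Carrier → ℕ) (φ : Carrier → Carrier) (h : Carrier → ℕ) →
    ∑ elements (λ b → w b *ℕ h (φ b)) ≡ ∑ elements (λ y → ∑ elements (λ b → w b *ℕ δ (φ b) y) *ℕ h y)
  ∑-pushforward w φ h = begin
    ∑ elements (λ b → w b *ℕ h (φ b))
      ≡⟨ ∑-cong elements (λ b → cong (w b *ℕ_) (∑-select (φ b) h)) ⟨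
    ∑ elements (λ b → w b *ℕ ∑ elements (λ y → δ (φ b) y *ℕ h y))
      ≡⟨ ∑-cong elements (λ b → ∑-*ˡ elements (w b) _) ⟨
    ∑ elements (λ b → ∑ elements (λ y → w b *ℕ (δ (φ b) y *ℕ h y)))
      ≡⟨ ∑-comm elements elements _ ⟩
    ∑ elements (λ y → ∑ elements (λ b → w b *ℕ (δ (φ b) y *ℕ h y)))
      ≡⟨ ∑-cong elements (λ y → ∑-cong elements (λ b → ℕ.*-assoc (w b) _ (h y))) ⟨
    ∑ elements (λ y → ∑ elements (λ b → w b *ℕ δ (φ b) y *ℕ h y))
      ≡⟨ ∑-cong elements (λ y → ∑-*ʳ elements (h y) _) ⟩
    ∑ elements (λ y → ∑ elements (λ b → w b *ℕ δ (φ b) y) *ℕ h y) ∎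

  δ-partition : ∀ a b k → k ≡ δ a 0# *ℕ k +ℕ (δ≢ a 0# *ℕ (δ b 0# *ℕ k) +ℕ δ≢ a 0# *ℕ (δ≢ b 0# *ℕ k))
  δ-partition a b k = trans (split a k) (cong (δ a 0# *ℕ k +ℕ_) (trans (cong (δ≢ a 0# *ℕ_) (split b k)) (ℕ.*-distribˡ-+ (δ≢ a 0#) _ _)))
    where
    split : ∀ x k → k ≡ δ x 0# *ℕ k +ℕ δ≢ x 0# *ℕ k
    split x k = trans (sym (ℕ.*-identityˡ k)) (trans (cong (_*ℕ k) (sym (δ+δ≢≡1 x 0#))) (ℕ.*-distribʳ-+ k (δ x 0#) (δ≢ x 0#)))

  δ-square-nonzero : ∀ {y} → y ≢ 0# → ∀ b → δ (b * b) y ≡ δ≢ b 0# *ℕ δ (b * b) y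
  δ-square-nonzero y≢0 b with b ≟ 0#
  ... | yes refl = δ-≢ (λ 0*0≡y → y≢0 (trans (sym 0*0≡y) (zeroˡ 0#)))
  ... | no  _    = sym (ℕ.+-identityʳ _)

  n : ℕ
  n = size ∸ 1

  ∑-nonzero : ∑ elements (λ y → δ≢ y 0#) ≡ n
  ∑-nonzero = begin
    ∑ elements (λ y → δ≢ y 0#)                  ≡⟨ ℕ.m+n∸m≡n 1 _ ⟨
    1 +ℕ ∑ elements (λ y → δ≢ y 0#) ∸ 1         ≡⟨ cong (λ k → k +ℕ ∑ elements (λ y → δ≢ y 0#) ∸ 1) (∑-δ≡1 0#) ⟨
    ∑ elements (λ y → δ y 0#) +ℕ ∑ elements (λ y → δ≢ y 0#) ∸ 1
                                                ≡⟨ cong (_∸ 1) (∑-distrib-+ elements _ _) ⟨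
    ∑ elements (λ y → δ y 0# +ℕ δ≢ y 0#) ∸ 1    ≡⟨ cong (_∸ 1) (∑-cong elements (λ y → δ+δ≢≡1 y 0#)) ⟩
    ∑ elements (λ _ → 1) ∸ 1                    ≡⟨ cong (_∸ 1) (trans (∑-const elements 1) (ℕ.*-identityʳ size)) ⟩
    n                                           ∎

  length-via-multiplicity : ∀ xs → length xs ≡ ∑ elements (multiplicity xs)
  length-via-multiplicity xs = begin
    length xs                                        ≡⟨ ℕ.*-identityʳ _ ⟨
    length xs *ℕ 1                                   ≡⟨ ∑-const xs 1 ⟨
    ∑ xs (λ _ → 1)                                   ≡⟨ ∑-via-multiplicity xs (λ _ → 1) ⟩
    ∑ elements (λ y → multiplicity xs y *ℕ 1)        ≡⟨ ∑-cong elements (λ y → ℕ.*-identityʳ _) ⟩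
    ∑ elements (multiplicity xs)                     ∎

  Unique-nonzero⇒length≤n : ∀ {xs} → Unique xs → All.All (_≢ 0#) xs → length xs ≤ℕ n
  Unique-nonzero⇒length≤n {xs} uniq nonzero =
    subst₂ _≤ℕ_ (sym (length-via-multiplicity xs)) ∑-nonzero (∑-mono-≤ elements bound)
    where
    bound : ∀ y → multiplicity xs y ≤ℕ δ≢ y 0#
    bound y with y ≟ 0#
    ... | yes refl = ℕ.≤-reflexive (multiplicity-∉ (λ 0∈xs → All.lookup nonzero 0∈xs refl))
    ... | no  _    = multiplicity-Unique y uniq

  nonzero⊆⇒n≤length : ∀ {xs} → (∀ {y} → y ≢ 0# → y ∈ xs) → n ≤ℕ length xs
  nonzero⊆⇒n≤length {xs} covers =
    subst₂ _≤ℕ_ ∑-nonzero (sym (length-via-multiplicity xs)) (∑-mono-≤ elements bound)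
    where
    bound : ∀ y → δ≢ y 0# ≤ℕ multiplicity xs y
    bound y with y ≟ 0#
    ... | yes _   = z≤n
    ... | no  y≢0 = multiplicity-∈ (covers y≢0)

  instance
    n-nonZero : NonZero n
    n-nonZero = ℕ.>-nonZero (Unique-nonzero⇒length≤n {1# ∷ []} ([] ∷ []) ((0≢1 ∘ sym) ∷ []))

  size%d≡1⇒d∣n : ∀ d .{{_ : NonZero d}} → size % d ≡ 1 → d ∣ n
  size%d≡1⇒d∣n d size%d≡1 = divides (size / d) (cong (_∸ 1) (trans (m≡m%n+[m/n]*n size d) (cong (_+ℕ size / d *ℕ d) size%d≡1)))

  size≡1+n : size ≡ suc n
  size≡1+n = sym (trans (ℕ.+-comm 1 n) (ℕ.m∸n+n≡m 1≤size))
    where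
    1≤size : 1 ≤ℕ size
    1≤size = ℕ.n≢0⇒n>0 (λ size≡0 → ℕ.≢-nonZero⁻¹ n (cong (_∸ 1) size≡0))

  ∑-δ-injective : ∀ (f : Carrier → Carrier) {c g} → (∀ {a b} → f a ≡ f b → a ≡ b) → f c ≡ g →
                  ∑ elements (λ a → δ (f a) g) ≡ 1
  ∑-δ-injective f {c} f-injective fc≡g = trans
    (∑-cong elements (λ a → δ-cong (λ fa≡g → f-injective (trans fa≡g (sym fc≡g))) (λ a≡c → trans (cong f a≡c) fc≡g)))
    (∑-δ≡1 c)

  a-[a-x]≡x : ∀ a x → a - (a - x) ≡ x
  a-[a-x]≡x a x = begin
    a - (a - x)        ≡⟨ cong (a +_) (-‿+-comm a (- x)) ⟨
    a + (- a - - x)    ≡⟨ +-assoc a (- a) _ ⟨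
    a - a - - x        ≡⟨ cong₂ _+_ (-‿inverseʳ a) (-‿involutive x) ⟩
    0# + x             ≡⟨ +-identityˡ x ⟩
    x                  ∎

  a²-[a-w]²≡w[2a-w] : ∀ a w → a * a - (a - w) * (a - w) ≡ w * (a + a - w)
  a²-[a-w]²≡w[2a-w] a w = begin
    a * a - (a - w) * (a - w)          ≡⟨ [x-y][x+y]≡x²-y² a (a - w) ⟨
    (a - (a - w)) * (a + (a - w))      ≡⟨ cong₂ _*_ (a-[a-x]≡x a w) (sym (+-assoc a a (- w))) ⟩
    w * (a + a - w)                    ∎

  -- Substituting b = a − w turns a² − b² into w(2a − w), which for w ≠ 0 equals g for exactly one a.
  ∑-difference-of-squares : 2# ≢ 0# → ∀ {g} → g ≢ 0# →
                            ∑ elements (λ a → ∑ elements (λ b → δ (a * a - b * b) g)) ≡ n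
  ∑-difference-of-squares 2≢0 {g} g≢0 = begin
    ∑ elements (λ a → ∑ elements (λ b → δ (a * a - b * b) g))
      ≡⟨ ∑-cong elements (λ a → ∑-reindex (λ x → a - x) (λ x → a - x) (a-[a-x]≡x a) (a-[a-x]≡x a) (λ b → δ (a * a - b * b) g)) ⟨
    ∑ elements (λ a → ∑ elements (λ w → δ (a * a - (a - w) * (a - w)) g))
      ≡⟨ ∑-cong elements (λ a → ∑-cong elements (λ w → cong (λ x → δ x g) (a²-[a-w]²≡w[2a-w] a w))) ⟩
    ∑ elements (λ a → ∑ elements (λ w → δ (w * (a + a - w)) g))
      ≡⟨ ∑-comm elements elements _ ⟩
    ∑ elements (λ w → ∑ elements (λ a → δ (w * (a + a - w)) g))
      ≡⟨ ∑-cong elements row ⟩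
    ∑ elements (λ w → δ≢ w 0#)
      ≡⟨ ∑-nonzero ⟩
    n ∎
    where
    row : ∀ w → ∑ elements (λ a → δ (w * (a + a - w)) g) ≡ δ≢ w 0#
    row w with w ≟ 0#
    ... | yes refl = ∑-zero elements (λ a → δ-≢ (λ 0*_≡g → g≢0 (trans (sym 0*_≡g) (zeroˡ _))))
    ... | no  w≢0  = ∑-δ-injective (λ a → w * (a + a - w)) injective preimage
      where
      injective : ∀ {a b} → w * (a + a - w) ≡ w * (b + b - w) → a ≡ b
      injective {a} {b} eq = *-cancelˡ 2≢0
        (trans (sym (x+x≡2x a)) (trans (+-cancelʳ (- w) (a + a) (b + b) (*-cancelˡ w≢0 eq)) (x+x≡2x b)))

      w⁻¹ ½ c : Carrier
      w⁻¹ = proj₁ (inverse w w≢0)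
      ½   = proj₁ (inverse 2# 2≢0)
      c   = (g * w⁻¹ + w) * ½

      preimage : w * (c + c - w) ≡ g
      preimage = begin
        w * (c + c - w)                    ≡⟨ cong (λ x → w * (x - w)) (x+x≡2x c) ⟩
        w * (2# * ((g * w⁻¹ + w) * ½) - w) ≡⟨ cong (λ x → w * (x - w)) (*-comm 2# _) ⟩
        w * ((g * w⁻¹ + w) * ½ * 2# - w)   ≡⟨ cong (λ x → w * (x - w)) (*-assoc (g * w⁻¹ + w) ½ 2#) ⟩
        w * ((g * w⁻¹ + w) * (½ * 2#) - w) ≡⟨ cong (λ x → w * ((g * w⁻¹ + w) * x - w)) (trans (*-comm ½ 2#) (proj₂ (inverse 2# 2≢0))) ⟩
        w * ((g * w⁻¹ + w) * 1# - w)       ≡⟨ cong (λ x → w * (x - w)) (*-identityʳ _) ⟩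
        w * ((g * w⁻¹ + w) - w)            ≡⟨ cong (w *_) (+-assoc (g * w⁻¹) w (- w)) ⟩
        w * (g * w⁻¹ + (w - w))            ≡⟨ cong (λ x → w * (g * w⁻¹ + x)) (-‿inverseʳ w) ⟩
        w * (g * w⁻¹ + 0#)                 ≡⟨ cong (w *_) (+-identityʳ _) ⟩
        w * (g * w⁻¹)                      ≡⟨ cong (w *_) (*-comm g w⁻¹) ⟩
        w * (w⁻¹ * g)                      ≡⟨ *-assoc w w⁻¹ g ⟨
        w * w⁻¹ * g                        ≡⟨ cong (_* g) (proj₂ (inverse w w≢0)) ⟩
        1# * g                             ≡⟨ *-identityˡ g ⟩
        g                                  ∎

  δ[x-x]≡0 : ∀ {g} → g ≢ 0# → ∀ x → δ (x - x) g ≡ 0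
  δ[x-x]≡0 g≢0 x = δ-≢ (λ x-x≡g → g≢0 (trans (sym x-x≡g) (-‿inverseʳ x)))

  multΔ≡multΔ₂ : ∀ {g} → g ≢ 0# → ∀ D → multΔ D g ≡ multΔ₂ D D g
  multΔ≡multΔ₂ {g} g≢0 D = ∑-cong D (λ x → ∑-cong D (λ y → off-diagonal x y))
    where
    off-diagonal : ∀ x y → δ≢ x y *ℕ δ (x - y) g ≡ δ (x - y) g
    off-diagonal x y with x ≟ y
    ... | yes refl = sym (δ[x-x]≡0 g≢0 x)
    ... | no  _    = ℕ.+-identityʳ _

  multΔ-0 : ∀ D → multΔ D 0# ≡ 0
  multΔ-0 D = ∑-zero D (λ x → ∑-zero D (λ y → off-diagonal x y))
    where
    off-diagonal : ∀ x y → δ≢ x y *ℕ δ (x - y) 0# ≡ 0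
    off-diagonal x y with x ≟ y
    ... | yes _   = refl
    ... | no  x≢y = trans (ℕ.+-identityʳ _) (δ-≢ (x≢y ∘ x∙y⁻¹≈ε⇒x≈y x y))

  block : Carrier → Carrier → List Carrier
  block u v = u ∷ - u ∷ v ∷ - v ∷ []

  multiplicity-block : ∀ u v y → multiplicity (block u v) y ≡ ±δ u y +ℕ ±δ v y
  multiplicity-block u v y = regroup (δ u y) (δ (- u) y) (δ v y) (δ (- v) y)
    where
    regroup : ∀ a b c d → a +ℕ (b +ℕ (c +ℕ (d +ℕ 0))) ≡ a +ℕ b +ℕ (c +ℕ d)
    regroup = solve-∀

  Δ-block : ∀ {g} → g ≢ 0# → ∀ u v → multΔ₂ (block u v) (block u v) g
            ≡ ±δ (u + u) g +ℕ ±δ (v + v) g +ℕ 2 *ℕ (±δ (u - v) g +ℕ ±δ (u + v) g)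
  Δ-block {g} g≢0 u v = begin
    multΔ₂ (block u v) (block u v) g
      ≡⟨ cong₂ _+ℕ_ row-u (cong₂ _+ℕ_ row-[-u] (cong₂ _+ℕ_ row-v (cong (_+ℕ 0) row-[-v]))) ⟩
    (0 +ℕ (P (u + u) +ℕ (P (u - v) +ℕ (P (u + v) +ℕ 0))))
      +ℕ ((N (u + u) +ℕ (0 +ℕ (N (u + v) +ℕ (N (u - v) +ℕ 0))))
      +ℕ ((N (u - v) +ℕ (P (u + v) +ℕ (0 +ℕ (P (v + v) +ℕ 0))))
      +ℕ ((N (u + v) +ℕ (P (u - v) +ℕ (N (v + v) +ℕ (0 +ℕ 0)))) +ℕ 0)))
      ≡⟨ regroup (P (u + u)) (N (u + u)) (P (v + v)) (N (v + v)) (P (u - v)) (N (u - v)) (P (u + v)) (N (u + v)) ⟩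
    ±δ (u + u) g +ℕ ±δ (v + v) g +ℕ 2 *ℕ (±δ (u - v) g +ℕ ±δ (u + v) g) ∎
    where
    P N : Carrier → ℕ
    P x = δ x g
    N x = δ (- x) g

    at : ∀ {x y} → x ≡ y → δ x g ≡ δ y g
    at = cong (λ z → δ z g)

    x--y≡x+y : ∀ x y → x - (- y) ≡ x + y
    x--y≡x+y x y = cong (x +_) (-‿involutive y)

    row-u : ∑ (block u v) (λ y → δ (u - y) g) ≡ 0 +ℕ (P (u + u) +ℕ (P (u - v) +ℕ (P (u + v) +ℕ 0)))
    row-u = cong₂ _+ℕ_ (δ[x-x]≡0 g≢0 u)
              (cong₂ _+ℕ_ (at (x--y≡x+y u u)) (cong (P (u - v) +ℕ_) (cong (_+ℕ 0) (at (x--y≡x+y u v)))))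

    row-[-u] : ∑ (block u v) (λ y → δ (- u - y) g) ≡ N (u + u) +ℕ (0 +ℕ (N (u + v) +ℕ (N (u - v) +ℕ 0)))
    row-[-u] = cong₂ _+ℕ_ (at (-‿+-comm u u))
                 (cong₂ _+ℕ_ (δ[x-x]≡0 g≢0 (- u)) (cong₂ _+ℕ_ (at (-‿+-comm u v)) (cong (_+ℕ 0) (at (-‿+-comm u (- v))))))

    row-v : ∑ (block u v) (λ y → δ (v - y) g) ≡ N (u - v) +ℕ (P (u + v) +ℕ (0 +ℕ (P (v + v) +ℕ 0)))
    row-v = cong₂ _+ℕ_ (at (sym (⁻¹-anti-homo‿- u v)))
              (cong₂ _+ℕ_ (at (trans (x--y≡x+y v u) (+-comm v u)))
                (cong₂ _+ℕ_ (δ[x-x]≡0 g≢0 v) (cong (_+ℕ 0) (at (x--y≡x+y v v)))))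

    row-[-v] : ∑ (block u v) (λ y → δ (- v - y) g) ≡ N (u + v) +ℕ (P (u - v) +ℕ (N (v + v) +ℕ (0 +ℕ 0)))
    row-[-v] = cong₂ _+ℕ_ (at (trans (-‿+-comm v u) (cong -_ (+-comm v u))))
                 (cong₂ _+ℕ_ (at (trans (x--y≡x+y (- v) u) (+-comm (- v) u)))
                   (cong₂ _+ℕ_ (at (-‿+-comm v v)) (cong (_+ℕ 0) (δ[x-x]≡0 g≢0 (- v)))))

    regroup : ∀ a a' b b' c c' d d' →
      (0 +ℕ (a +ℕ (c +ℕ (d +ℕ 0)))) +ℕ ((a' +ℕ (0 +ℕ (d' +ℕ (c' +ℕ 0))))
        +ℕ ((c' +ℕ (d +ℕ (0 +ℕ (b +ℕ 0)))) +ℕ ((d' +ℕ (c +ℕ (b' +ℕ (0 +ℕ 0)))) +ℕ 0)))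
      ≡ (a +ℕ a') +ℕ (b +ℕ b') +ℕ 2 *ℕ ((c +ℕ c') +ℕ (d +ℕ d'))
    regroup = solve-∀

  δFin≢-≡ : ∀ {m} {i j : Fin m} → i ≡ j → δFin≢ i j ≡ 0
  δFin≢-≡ {i = i} {j} i≡j with i ≟ᶠ j
  ... | yes _   = refl
  ... | no  i≢j = ⊥-elim (i≢j i≡j)

  δFin≢-≢ : ∀ {m} {i j : Fin m} → i ≢ j → δFin≢ i j ≡ 1
  δFin≢-≢ {i = i} {j} i≢j with i ≟ᶠ j
  ... | yes i≡j = ⊥-elim (i≢j i≡j)
  ... | no  _   = refl

  δFin≢-suc : ∀ {m} (i j : Fin m) → δFin≢ (Fin.suc i) (Fin.suc j) ≡ δFin≢ i j
  δFin≢-suc i j = case i ≟ᶠ j of λ where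
    (yes i≡j) → trans (δFin≢-≡ (cong Fin.suc i≡j)) (sym (δFin≢-≡ i≡j))
    (no  i≢j) → trans (δFin≢-≢ (i≢j ∘ Fin.suc-injective)) (sym (δFin≢-≢ i≢j))

  ∑-off-diagonal-row : ∀ m (G : Fin m → ℕ) i → ∑ (allFin m) (λ j → δFin≢ i j *ℕ G j) +ℕ G i ≡ ∑ (allFin m) G
  ∑-off-diagonal-row (suc m) G Fin.zero = begin
    ∑ (allFin (suc m)) (λ j → δFin≢ Fin.zero j *ℕ G j) +ℕ G Fin.zero
      ≡⟨ cong (_+ℕ G Fin.zero) (∑-allFin-suc m (λ j → δFin≢ Fin.zero j *ℕ G j)) ⟩
    δFin≢ {suc m} Fin.zero Fin.zero *ℕ G Fin.zero +ℕ ∑ (allFin m) (λ j → δFin≢ Fin.zero (Fin.suc j) *ℕ G (Fin.suc j)) +ℕ G Fin.zero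
      ≡⟨ cong₂ (λ a b → a *ℕ G Fin.zero +ℕ b +ℕ G Fin.zero) (δFin≢-≡ {i = Fin.zero {m}} refl)
               (∑-cong (allFin m) (λ j → trans (cong (_*ℕ G (Fin.suc j)) (δFin≢-≢ {i = Fin.zero} {Fin.suc j} λ ()))
                                              (ℕ.*-identityˡ _))) ⟩
    ∑ (allFin m) (G ∘ Fin.suc) +ℕ G Fin.zero
      ≡⟨ ℕ.+-comm _ (G Fin.zero) ⟩
    G Fin.zero +ℕ ∑ (allFin m) (G ∘ Fin.suc)
      ≡⟨ ∑-allFin-suc m G ⟨
    ∑ (allFin (suc m)) G ∎
  ∑-off-diagonal-row (suc m) G (Fin.suc i) = begin
    ∑ (allFin (suc m)) (λ j → δFin≢ (Fin.suc i) j *ℕ G j) +ℕ G (Fin.suc i)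
      ≡⟨ cong (_+ℕ G (Fin.suc i)) (∑-allFin-suc m (λ j → δFin≢ (Fin.suc i) j *ℕ G j)) ⟩
    δFin≢ (Fin.suc i) Fin.zero *ℕ G Fin.zero +ℕ ∑ (allFin m) (λ j → δFin≢ (Fin.suc i) (Fin.suc j) *ℕ G (Fin.suc j))
      +ℕ G (Fin.suc i)
      ≡⟨ cong₂ (λ a b → a *ℕ G Fin.zero +ℕ b +ℕ G (Fin.suc i)) (δFin≢-≢ {i = Fin.suc i} {Fin.zero} λ ())
               (∑-cong (allFin m) (λ j → cong (_*ℕ G (Fin.suc j)) (δFin≢-suc i j))) ⟩
    1 *ℕ G Fin.zero +ℕ ∑ (allFin m) (λ j → δFin≢ i j *ℕ G (Fin.suc j)) +ℕ G (Fin.suc i)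
      ≡⟨ ℕ.+-assoc (1 *ℕ G Fin.zero) _ _ ⟩
    1 *ℕ G Fin.zero +ℕ (∑ (allFin m) (λ j → δFin≢ i j *ℕ G (Fin.suc j)) +ℕ G (Fin.suc i))
      ≡⟨ cong₂ _+ℕ_ (ℕ.*-identityˡ _) (∑-off-diagonal-row m (G ∘ Fin.suc) i) ⟩
    G Fin.zero +ℕ ∑ (allFin m) (G ∘ Fin.suc)
      ≡⟨ ∑-allFin-suc m G ⟨
    ∑ (allFin (suc m)) G ∎

  ∑-off-diagonal : ∀ m (G : Fin m → Fin m → ℕ) →
    ∑ (allFin m) (λ i → ∑ (allFin m) (λ j → δFin≢ i j *ℕ G i j)) +ℕ ∑ (allFin m) (λ i → G i i)
    ≡ ∑ (allFin m) (λ i → ∑ (allFin m) (G i))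
  ∑-off-diagonal m G = trans (sym (∑-distrib-+ (allFin m) _ _))
                             (∑-cong (allFin m) (λ i → ∑-off-diagonal-row m (G i) i))

  multΔ₂-concatˡ : ∀ 𝒟 B g → multΔ₂ (concat 𝒟) B g ≡ ∑ 𝒟 (λ D → multΔ₂ D B g)
  multΔ₂-concatˡ 𝒟 B g = ∑-concat 𝒟 _

  multΔ₂-concatʳ : ∀ A 𝒟 g → multΔ₂ A (concat 𝒟) g ≡ ∑ 𝒟 (λ D → multΔ₂ A D g)
  multΔ₂-concatʳ A 𝒟 g = trans (∑-cong A (λ x → ∑-concat 𝒟 _)) (∑-comm A 𝒟 _)

  multEPDF+diagonal : ∀ 𝒟 g → multEPDF 𝒟 g +ℕ ∑ 𝒟 (λ D → multΔ₂ D D g) ≡ multΔ₂ (concat 𝒟) (concat 𝒟) g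
  multEPDF+diagonal 𝒟 g = begin
    multEPDF 𝒟 g +ℕ ∑ 𝒟 (λ D → multΔ₂ D D g)
      ≡⟨ cong (multEPDF 𝒟 g +ℕ_) (∑-lookup 𝒟 (λ D → multΔ₂ D D g)) ⟨
    ∑ I (λ i → ∑ I (λ j → δFin≢ i j *ℕ G i j)) +ℕ ∑ I (λ i → G i i)
      ≡⟨ ∑-off-diagonal (length 𝒟) G ⟩
    ∑ I (λ i → ∑ I (G i))
      ≡⟨ ∑-cong I (λ i → ∑-lookup 𝒟 (λ D′ → multΔ₂ (lookup 𝒟 i) D′ g)) ⟩
    ∑ I (λ i → ∑ 𝒟 (λ D′ → multΔ₂ (lookup 𝒟 i) D′ g))
      ≡⟨ ∑-lookup 𝒟 (λ D → ∑ 𝒟 (λ D′ → multΔ₂ D D′ g)) ⟩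
    ∑ 𝒟 (λ D → ∑ 𝒟 (λ D′ → multΔ₂ D D′ g))
      ≡⟨ ∑-cong 𝒟 (λ D → multΔ₂-concatʳ D 𝒟 g) ⟨
    ∑ 𝒟 (λ D → multΔ₂ D (concat 𝒟) g)
      ≡⟨ multΔ₂-concatˡ 𝒟 (concat 𝒟) g ⟨
    multΔ₂ (concat 𝒟) (concat 𝒟) g ∎
    where
    I = allFin (length 𝒟)
    G : Fin (length 𝒟) → Fin (length 𝒟) → ℕ
    G i j = multΔ₂ (lookup 𝒟 i) (lookup 𝒟 j) g

  multEPDF-0 : ∀ 𝒟 → (∀ i j → i ≢ j → ∀ x → x ∈ lookup 𝒟 i → x ∉ lookup 𝒟 j) → multEPDF 𝒟 0# ≡ 0
  multEPDF-0 𝒟 disjoint = ∑-zero (allFin (length 𝒟)) λ i → ∑-zero (allFin (length 𝒟)) λ j →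
    case i ≟ᶠ j of λ where
      (yes i≡j) → cong (_*ℕ multΔ₂ (lookup 𝒟 i) (lookup 𝒟 j) 0#) (δFin≢-≡ i≡j)
      (no  i≢j) → trans (cong (δFin≢ i j *ℕ_) (no-zero-difference i j i≢j)) (ℕ.*-zeroʳ (δFin≢ i j))
    where
    no-zero-difference : ∀ i j → i ≢ j → multΔ₂ (lookup 𝒟 i) (lookup 𝒟 j) 0# ≡ 0
    no-zero-difference i j i≢j = ∑-zero-∈ (lookup 𝒟 i) λ {x} x∈𝒟ᵢ → ∑-zero-∈ (lookup 𝒟 j) λ {y} y∈𝒟ⱼ →
      δ-≢ λ x-y≡0 → disjoint i j i≢j x x∈𝒟ᵢ (subst (_∈ lookup 𝒟 j) (sym (x∙y⁻¹≈ε⇒x≈y x y x-y≡0)) y∈𝒟ⱼ)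

  ^-+ : ∀ x a b → x ^ (a +ℕ b) ≡ x ^ a * x ^ b
  ^-+ x zero    b = sym (*-identityˡ _)
  ^-+ x (suc a) b = trans (cong (x *_) (^-+ x a b)) (sym (*-assoc x (x ^ a) (x ^ b)))

  1^ : ∀ k → 1# ^ k ≡ 1#
  1^ zero    = refl
  1^ (suc k) = trans (*-identityˡ _) (1^ k)

  ^-* : ∀ x a b → x ^ (a *ℕ b) ≡ (x ^ a) ^ b
  ^-* x a zero    = cong (x ^_) (ℕ.*-zeroʳ a)
  ^-* x a (suc b) = begin
    x ^ (a *ℕ suc b)        ≡⟨ cong (x ^_) (ℕ.*-suc a b) ⟩
    x ^ (a +ℕ a *ℕ b)       ≡⟨ ^-+ x a (a *ℕ b) ⟩
    x ^ a * x ^ (a *ℕ b)    ≡⟨ cong (x ^ a *_) (^-* x a b) ⟩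
    x ^ a * (x ^ a) ^ b     ∎

  ^-nonzero : ∀ {x} k → x ≢ 0# → x ^ k ≢ 0#
  ^-nonzero zero    x≢0 = 0≢1 ∘ sym
  ^-nonzero (suc k) x≢0 = *-nonzero x≢0 (^-nonzero k x≢0)

  module Primitive (α : Carrier) (α-primitive : IsPrimitive α) where

    α^-nonzero : ∀ k → α ^ k ≢ 0#
    α^-nonzero k = ^-nonzero k (proj₁ α-primitive)

    α^i≡α^j⇒α^[j∸i]≡1 : ∀ {i j} → i ≤ℕ j → α ^ i ≡ α ^ j → α ^ (j ∸ i) ≡ 1#
    α^i≡α^j⇒α^[j∸i]≡1 {i} {j} i≤j α^i≡α^j = sym (*-cancelˡ (α^-nonzero i) (begin
      α ^ i * 1#            ≡⟨ *-identityʳ (α ^ i) ⟩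
      α ^ i                 ≡⟨ α^i≡α^j ⟩
      α ^ j                 ≡⟨ cong (α ^_) (ℕ.m+[n∸m]≡n i≤j) ⟨
      α ^ (i +ℕ (j ∸ i))    ≡⟨ ^-+ α i (j ∸ i) ⟩
      α ^ i * α ^ (j ∸ i)   ∎))

    α^k≡α^[k%s] : ∀ s k .{{_ : NonZero s}} → α ^ s ≡ 1# → α ^ k ≡ α ^ (k % s)
    α^k≡α^[k%s] s k α^s≡1 = begin
      α ^ k                                ≡⟨ cong (α ^_) (m≡m%n+[m/n]*n k s) ⟩
      α ^ (k % s +ℕ k / s *ℕ s)            ≡⟨ ^-+ α (k % s) _ ⟩
      α ^ (k % s) * α ^ (k / s *ℕ s)       ≡⟨ cong (λ e → α ^ (k % s) * α ^ e) (ℕ.*-comm (k / s) s) ⟩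
      α ^ (k % s) * α ^ (s *ℕ (k / s))     ≡⟨ cong (α ^ (k % s) *_) (^-* α s (k / s)) ⟩
      α ^ (k % s) * (α ^ s) ^ (k / s)      ≡⟨ cong (λ x → α ^ (k % s) * x ^ (k / s)) α^s≡1 ⟩
      α ^ (k % s) * 1# ^ (k / s)           ≡⟨ cong (α ^ (k % s) *_) (1^ (k / s)) ⟩
      α ^ (k % s) * 1#                     ≡⟨ *-identityʳ _ ⟩
      α ^ (k % s)                          ∎

    α^s≡1⇒n≤s : ∀ {s} .{{_ : NonZero s}} → α ^ s ≡ 1# → n ≤ℕ s
    α^s≡1⇒n≤s {s} α^s≡1 = subst (n ≤ℕ_) (length-tabulate (λ (i : Fin s) → α ^ toℕ i))
                                 (nonzero⊆⇒n≤length powers-cover)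
      where
      powers-cover : ∀ {y} → y ≢ 0# → y ∈ tabulate (λ (i : Fin s) → α ^ toℕ i)
      powers-cover {y} y≢0 with proj₂ α-primitive y y≢0
      ... | k , α^k≡y = subst (_∈ tabulate _) (begin
        α ^ toℕ (fromℕ< (m%n<n k s))  ≡⟨ cong (α ^_) (toℕ-fromℕ< (m%n<n k s)) ⟩
        α ^ (k % s)                  ≡⟨ α^k≡α^[k%s] s k α^s≡1 ⟨
        α ^ k                        ≡⟨ α^k≡y ⟩
        y                            ∎) (∈-tabulate⁺ (fromℕ< (m%n<n k s)))

    -- If no α^s with 1 ≤ s ≤ n were 1, then α^0, …, α^n would be n + 1 distinct nonzero elements.
    α^n≡1 : α ^ n ≡ 1#
    α^n≡1 with any? (λ (i : Fin n) → (α ^ suc (toℕ i)) ≟ 1#)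
    ... | yes (i , α^s≡1) = subst (λ s → α ^ s ≡ 1#) (ℕ.≤-antisym (toℕ<n i) (α^s≡1⇒n≤s α^s≡1)) α^s≡1
    ... | no  ∄s          = ⊥-elim (ℕ.<-irrefl refl (subst (_≤ℕ n) (length-tabulate powers)
                                                    (Unique-nonzero⇒length≤n powers-unique powers-nonzero)))
      where
      powers : Fin (suc n) → Carrier
      powers i = α ^ toℕ i

      powers-nonzero : All.All (_≢ 0#) (tabulate powers)
      powers-nonzero = AllP.tabulate⁺ (α^-nonzero ∘ toℕ)

      α^d≢1 : ∀ {d} → 0 ℕ.< d → d ≤ℕ n → α ^ d ≢ 1#
      α^d≢1 {suc d} _ d<n α^d≡1 = ∄s (fromℕ< d<n , subst (λ k → α ^ suc k ≡ 1#) (sym (toℕ-fromℕ< d<n)) α^d≡1)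

      distinct : ∀ {a b} → a ℕ.< b → b ≤ℕ n → α ^ a ≢ α ^ b
      distinct {a} {b} a<b b≤n α^a≡α^b =
        α^d≢1 (ℕ.m<n⇒0<n∸m a<b) (ℕ.≤-trans (ℕ.m∸n≤m b a) b≤n) (α^i≡α^j⇒α^[j∸i]≡1 (ℕ.<⇒≤ a<b) α^a≡α^b)

      powers-unique : Unique (tabulate powers)
      powers-unique = UniqueP.tabulate⁺ injective
        where
        injective : ∀ {i j} → powers i ≡ powers j → i ≡ j
        injective {i} {j} eq with <-cmp i j
        ... | tri< i<j _ _ = ⊥-elim (distinct i<j (ℕ.≤-pred (toℕ<n j)) eq)
        ... | tri≈ _ i≡j _ = i≡j
        ... | tri> _ _ j<i = ⊥-elim (distinct j<i (ℕ.≤-pred (toℕ<n i)) (sym eq))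

    α^t≢1 : ∀ {t} → 0 ℕ.< t → t ℕ.< n → α ^ t ≢ 1#
    α^t≢1 0<t t<n α^t≡1 = ℕ.<⇒≱ t<n (α^s≡1⇒n≤s {{ℕ.>-nonZero 0<t}} α^t≡1)

    α^d≡1⇒n∣d : ∀ {d} → α ^ d ≡ 1# → n ∣ d
    α^d≡1⇒n∣d {d} α^d≡1 = m%n≡0⇒n∣m d n d%n≡0
      where
      d%n≡0 : d % n ≡ 0
      d%n≡0 with d % n | m%n<n d n | α^k≡α^[k%s] n d α^n≡1
      ... | zero  | _   | _            = refl
      ... | suc r | r<n | α^d≡α^r+1 = ⊥-elim (α^t≢1 (s≤s z≤n) r<n (trans (sym α^d≡α^r+1) α^d≡1))

    module _ {h} (h+h≡n : h +ℕ h ≡ n) where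

      α^h≢1 : α ^ h ≢ 1#
      α^h≢1 = α^t≢1 0<h (subst (h ℕ.<_) h+h≡n (ℕ.m<m+n h 0<h))
        where
        0<h : 0 ℕ.< h
        0<h = ℕ.n≢0⇒n>0 (λ h≡0 → ℕ.≢-nonZero⁻¹ n (trans (sym h+h≡n) (cong₂ _+ℕ_ h≡0 h≡0)))

      α^h≡-1 : α ^ h ≡ - 1#
      α^h≡-1 with square-roots α^h²≡1²
        where
        α^h²≡1² : α ^ h * α ^ h ≡ 1# * 1#
        α^h²≡1² = begin
          α ^ h * α ^ h    ≡⟨ ^-+ α h h ⟨
          α ^ (h +ℕ h)     ≡⟨ cong (α ^_) h+h≡n ⟩
          α ^ n            ≡⟨ α^n≡1 ⟩
          1#               ≡⟨ *-identityˡ 1# ⟨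
          1# * 1#          ∎
      ... | inj₁ α^h≡1  = ⊥-elim (α^h≢1 α^h≡1)
      ... | inj₂ α^h≡-1 = α^h≡-1

      2≢0 : 2# ≢ 0#
      2≢0 1+1≡0 = α^h≢1 (trans α^h≡-1 (sym (+-inverseʳ-unique 1# 1# 1+1≡0)))

    α^[n*k]≡1 : ∀ k → α ^ (n *ℕ k) ≡ 1#
    α^[n*k]≡1 k = trans (^-* α n k) (trans (cong (_^ k) α^n≡1) (1^ k))

    module Classes (e : ℕ) .{{_ : NonZero e}} where

      InC-nonzero : ∀ {a x} → InC α e a x → x ≢ 0#
      InC-nonzero {a} (j , refl) = α^-nonzero (e *ℕ j +ℕ a)

      InC-* : ∀ {a b x y} → InC α e a x → InC α e b y → InC α e (a +ℕ b) (x * y)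
      InC-* {a} {b} (i , refl) (j , refl) = i +ℕ j , (begin
        α ^ (e *ℕ i +ℕ a) * α ^ (e *ℕ j +ℕ b)    ≡⟨ ^-+ α (e *ℕ i +ℕ a) _ ⟨
        α ^ (e *ℕ i +ℕ a +ℕ (e *ℕ j +ℕ b))       ≡⟨ cong (α ^_) (exponents e i a j b) ⟩
        α ^ (e *ℕ (i +ℕ j) +ℕ (a +ℕ b))          ∎)
        where
        exponents : ∀ e i a j b → e *ℕ i +ℕ a +ℕ (e *ℕ j +ℕ b) ≡ e *ℕ (i +ℕ j) +ℕ (a +ℕ b)
        exponents = solve-∀

      InC-reduce : ∀ {a x} → InC α e (a +ℕ e) x → InC α e a x
      InC-reduce {a} (j , x≡) = suc j , trans x≡ (cong (α ^_) (exponents e j a))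
        where
        exponents : ∀ e j a → e *ℕ j +ℕ (a +ℕ e) ≡ e *ℕ suc j +ℕ a
        exponents = solve-∀

      InC-classify : ∀ {x} → x ≢ 0# → ∃ λ a → a ℕ.< e × InC α e a x
      InC-classify {x} x≢0 with proj₂ α-primitive x x≢0
      ... | k , α^k≡x = k % e , m%n<n k e , k / e , sym (trans (cong (α ^_) k≡) α^k≡x)
        where
        k≡ : e *ℕ (k / e) +ℕ k % e ≡ k
        k≡ = trans (ℕ.+-comm (e *ℕ (k / e)) _)
                   (trans (cong (k % e +ℕ_) (ℕ.*-comm e (k / e))) (sym (m≡m%n+[m/n]*n k e)))

      -- The witness is α^(e j) · (α^(e i))⁻¹, where (α^(e i))⁻¹ = α^(e i (n − 1)).
      InC-quotient : ∀ {a c g} → InC α e a c → InC α e a g → ∃ λ x → InC α e 0 x × c * x ≡ g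
      InC-quotient {a} (i , refl) (j , refl) = α ^ (e *ℕ k +ℕ 0) , (k , refl) , (begin
        α ^ (e *ℕ i +ℕ a) * α ^ (e *ℕ k +ℕ 0)        ≡⟨ ^-+ α (e *ℕ i +ℕ a) _ ⟨
        α ^ (e *ℕ i +ℕ a +ℕ (e *ℕ k +ℕ 0))           ≡⟨ cong (α ^_) (exponents e i a j (ℕ.pred n)) ⟩
        α ^ (e *ℕ j +ℕ a +ℕ suc (ℕ.pred n) *ℕ (e *ℕ i)) ≡⟨ cong (λ m → α ^ (e *ℕ j +ℕ a +ℕ m *ℕ (e *ℕ i))) (ℕ.suc-pred n) ⟩
        α ^ (e *ℕ j +ℕ a +ℕ n *ℕ (e *ℕ i))           ≡⟨ ^-+ α (e *ℕ j +ℕ a) _ ⟩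
        α ^ (e *ℕ j +ℕ a) * α ^ (n *ℕ (e *ℕ i))      ≡⟨ cong (α ^ (e *ℕ j +ℕ a) *_) (α^[n*k]≡1 (e *ℕ i)) ⟩
        α ^ (e *ℕ j +ℕ a) * 1#                       ≡⟨ *-identityʳ _ ⟩
        α ^ (e *ℕ j +ℕ a)                            ∎)
        where
        k : ℕ
        k = j +ℕ i *ℕ ℕ.pred n
        exponents : ∀ e i a j p → e *ℕ i +ℕ a +ℕ (e *ℕ (j +ℕ i *ℕ p) +ℕ 0) ≡ e *ℕ j +ℕ a +ℕ suc p *ℕ (e *ℕ i)
        exponents = solve-∀

      [e*i+a]%e≡a : ∀ i {a} → a ℕ.< e → (e *ℕ i +ℕ a) % e ≡ a
      [e*i+a]%e≡a i {a} a<e = begin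
        (e *ℕ i +ℕ a) % e   ≡⟨ cong (_% e) (trans (ℕ.+-comm (e *ℕ i) a) (cong (a +ℕ_) (ℕ.*-comm e i))) ⟩
        (a +ℕ i *ℕ e) % e   ≡⟨ [m+kn]%n≡m%n a i e ⟩
        a % e               ≡⟨ m<n⇒m%n≡m a<e ⟩
        a                   ∎

      module _ (e∣n : e ∣ n) where

        α^k≡α^l⇒l%e≡k%e : ∀ {k l} → k ≤ℕ l → α ^ k ≡ α ^ l → l % e ≡ k % e
        α^k≡α^l⇒l%e≡k%e {k} {l} k≤l α^k≡α^l = begin
          l % e                 ≡⟨ cong (_% e) (ℕ.m+[n∸m]≡n k≤l) ⟨
          (k +ℕ (l ∸ k)) % e    ≡⟨ %-remove-+ʳ k (∣-trans e∣n (α^d≡1⇒n∣d (α^i≡α^j⇒α^[j∸i]≡1 k≤l α^k≡α^l))) ⟩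
          k % e                 ∎

        InC-unique : ∀ {a b x} → a ℕ.< e → b ℕ.< e → InC α e a x → InC α e b x → a ≡ b
        InC-unique {a} {b} a<e b<e (i , x≡α^k) (j , x≡α^l) with ℕ.≤-total (e *ℕ i +ℕ a) (e *ℕ j +ℕ b)
        ... | inj₁ k≤l = trans (sym ([e*i+a]%e≡a i a<e))
                               (trans (sym (α^k≡α^l⇒l%e≡k%e k≤l (trans (sym x≡α^k) x≡α^l))) ([e*i+a]%e≡a j b<e))
        ... | inj₂ l≤k = trans (sym ([e*i+a]%e≡a i a<e))
                               (trans (α^k≡α^l⇒l%e≡k%e l≤k (trans (sym x≡α^l) x≡α^k)) ([e*i+a]%e≡a j b<e))

      -1∈C₀ : 2 *ℕ e ∣ n → InC α e 0 (- 1#)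
      -1∈C₀ (divides m n≡m*2e) =
        m , sym (trans (cong (α ^_) (ℕ.+-identityʳ (e *ℕ m))) (α^h≡-1 {e *ℕ m} (trans (halves e m) (sym n≡m*2e))))
        where
        halves : ∀ e m → e *ℕ m +ℕ e *ℕ m ≡ m *ℕ (2 *ℕ e)
        halves = solve-∀

      InC-neg : 2 *ℕ e ∣ n → ∀ {a x} → InC α e a x → InC α e a (- x)
      InC-neg 2e∣n {a} {x} x∈Cₐ = subst (InC α e a) (-1*x≈-x x) (InC-* (-1∈C₀ 2e∣n) x∈Cₐ)

    module Quartic (8∣n : 8 ∣ n) where
      open Classes 4 public

      open _∣_ 8∣n using () renaming (quotient to N; equality to n≡N*8)

      4∣n : 4 ∣ n
      4∣n = ∣-trans (divides 2 refl) 8∣n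

      4N+4N≡n : 4 *ℕ N +ℕ 4 *ℕ N ≡ n
      4N+4N≡n = trans (octuple N) (sym n≡N*8)
        where
        octuple : ∀ N → 4 *ℕ N +ℕ 4 *ℕ N ≡ N *ℕ 8
        octuple = solve-∀

      2#≢0 : 2# ≢ 0#
      2#≢0 = 2≢0 {4 *ℕ N} 4N+4N≡n

      C₀∩C₂≡∅ : ∀ {x} → InC α 4 0 x → InC α 4 2 x → ⊥
      C₀∩C₂≡∅ x∈C₀ x∈C₂ with InC-unique 4∣n (s≤s z≤n) (s≤s (s≤s (s≤s z≤n))) x∈C₀ x∈C₂
      ... | ()

      InC₀∪C₂ : Carrier → Set
      InC₀∪C₂ y = InC α 4 0 y ⊎ InC α 4 2 y

      square-InC₀∪C₂ : ∀ {b} → b ≢ 0# → InC₀∪C₂ (b * b)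
      square-InC₀∪C₂ {b} b≢0 with proj₂ α-primitive b b≢0
      ... | k , refl with k % 2 | m%n<n k 2 | exponent
        where
        exponent : k +ℕ k ≡ 4 *ℕ (k / 2) +ℕ 2 *ℕ (k % 2)
        exponent = trans (cong (λ m → m +ℕ m) (m≡m%n+[m/n]*n k 2)) (doubling (k % 2) (k / 2))
          where
          doubling : ∀ r q → r +ℕ q *ℕ 2 +ℕ (r +ℕ q *ℕ 2) ≡ 4 *ℕ q +ℕ 2 *ℕ r
          doubling = solve-∀
      ... | 0 | _ | k+k≡ = inj₁ (k / 2 , trans (sym (^-+ α k k)) (cong (α ^_) k+k≡))
      ... | 1 | _ | k+k≡ = inj₂ (k / 2 , trans (sym (^-+ α k k)) (cong (α ^_) k+k≡))
      ... | suc (suc _) | s≤s (s≤s ()) | _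

      InC[2c]-square : ∀ c {y} → InC α 4 (2 *ℕ c) y → ∃ λ b → b ≢ 0# × b * b ≡ y
      InC[2c]-square c (j , refl) = α ^ (2 *ℕ j +ℕ c) , α^-nonzero (2 *ℕ j +ℕ c) , (begin
        α ^ (2 *ℕ j +ℕ c) * α ^ (2 *ℕ j +ℕ c)   ≡⟨ ^-+ α (2 *ℕ j +ℕ c) _ ⟨
        α ^ (2 *ℕ j +ℕ c +ℕ (2 *ℕ j +ℕ c))      ≡⟨ cong (α ^_) (doubling j c) ⟩
        α ^ (4 *ℕ j +ℕ 2 *ℕ c)                  ∎)
        where
        doubling : ∀ j c → 2 *ℕ j +ℕ c +ℕ (2 *ℕ j +ℕ c) ≡ 4 *ℕ j +ℕ 2 *ℕ c
        doubling = solve-∀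

      InC₀∪C₂-square : ∀ {y} → InC₀∪C₂ y → ∃ λ b → b ≢ 0# × b * b ≡ y
      InC₀∪C₂-square (inj₁ y∈C₀) = InC[2c]-square 0 y∈C₀
      InC₀∪C₂-square (inj₂ y∈C₂) = InC[2c]-square 1 y∈C₂

      -- ζ = α^((q−1)/8) is a primitive 8th root of unity and i = ζ² satisfies i² = −1, so that
      -- ((1 + i) ζ i)² = 2i · (−i) = 2.
      2-InC₀∪C₂ : InC₀∪C₂ 2#
      2-InC₀∪C₂ = subst InC₀∪C₂ w²≡2 (square-InC₀∪C₂ w≢0)
        where
        ζ i w : Carrier
        ζ = α ^ N
        i = α ^ (2 *ℕ N)
        w = (1# + i) * (ζ * i)

        ζ²≡i : ζ * ζ ≡ i
        ζ²≡i = trans (sym (^-+ α N N)) (cong (α ^_) (double N))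
          where
          double : ∀ N → N +ℕ N ≡ 2 *ℕ N
          double = solve-∀

        i²≡-1 : i * i ≡ - 1#
        i²≡-1 = trans (sym (^-+ α (2 *ℕ N) (2 *ℕ N))) (trans (cong (α ^_) (double N)) (α^h≡-1 {4 *ℕ N} 4N+4N≡n))
          where
          double : ∀ N → 2 *ℕ N +ℕ 2 *ℕ N ≡ 4 *ℕ N
          double = solve-∀

        [1+i]²≡2i : (1# + i) * (1# + i) ≡ 2# * i
        [1+i]²≡2i = begin
          (1# + i) * (1# + i)               ≡⟨ distribʳ (1# + i) 1# i ⟩
          1# * (1# + i) + i * (1# + i)      ≡⟨ cong₂ _+_ (*-identityˡ _) (distribˡ i 1# i) ⟩
          (1# + i) + (i * 1# + i * i)       ≡⟨ cong₂ (λ a b → (1# + i) + (a + b)) (*-identityʳ i) i²≡-1 ⟩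
          (1# + i) + (i + - 1#)             ≡⟨ cong ((1# + i) +_) (+-comm i (- 1#)) ⟩
          (1# + i) + (- 1# + i)             ≡⟨ +-interchange 1# i (- 1#) i ⟩
          (1# + - 1#) + (i + i)             ≡⟨ cong (_+ (i + i)) (-‿inverseʳ 1#) ⟩
          0# + (i + i)                      ≡⟨ +-identityˡ _ ⟩
          i + i                             ≡⟨ x+x≡2x i ⟩
          2# * i                            ∎

        w²≡2 : w * w ≡ 2#
        w²≡2 = begin
          ((1# + i) * (ζ * i)) * ((1# + i) * (ζ * i))   ≡⟨ *-interchange (1# + i) (ζ * i) (1# + i) (ζ * i) ⟩
          ((1# + i) * (1# + i)) * ((ζ * i) * (ζ * i))   ≡⟨ cong₂ _*_ [1+i]²≡2i (trans (*-interchange ζ i ζ i) (cong₂ _*_ ζ²≡i i²≡-1)) ⟩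
          (2# * i) * (i * - 1#)                         ≡⟨ *-assoc 2# i _ ⟩
          2# * (i * (i * - 1#))                         ≡⟨ cong (2# *_) (*-assoc i i (- 1#)) ⟨
          2# * (i * i * - 1#)                           ≡⟨ cong (λ a → 2# * (a * - 1#)) i²≡-1 ⟩
          2# * (- 1# * - 1#)                            ≡⟨ cong (2# *_) (trans (-1*x≈-x (- 1#)) (-‿involutive 1#)) ⟩
          2# * 1#                                       ≡⟨ *-identityʳ 2# ⟩
          2#                                            ∎

        w≢0 : w ≢ 0#
        w≢0 w≡0 = 2#≢0 (trans (sym w²≡2) (trans (cong (_* w) w≡0) (zeroˡ w)))

      C₀≢C₂ : ∀ {x y} → InC α 4 0 x → InC α 4 2 y → x ≢ y
      C₀≢C₂ x∈C₀ y∈C₂ refl = C₀∩C₂≡∅ x∈C₀ y∈C₂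

      InC-*C₀ : ∀ {b c r} → InC α 4 b c → InC α 4 0 r → InC α 4 b (c * r)
      InC-*C₀ {b} {c} {r} c∈C_b r∈C₀ = subst (λ k → InC α 4 k (c * r)) (ℕ.+-identityʳ b) (InC-* c∈C_b r∈C₀)

      InC-≡± : ∀ {a x y} → x ≡± y → InC α 4 a y → InC α 4 a x
      InC-≡± (inj₁ refl) y∈Cₐ = y∈Cₐ
      InC-≡± (inj₂ refl) y∈Cₐ = InC-neg 8∣n y∈Cₐ

      InCₐ⇒∉C₀∪C₂ : ∀ {a y} → a ℕ.< 4 → a ≢ 0 → a ≢ 2 → InC α 4 a y → ¬ InC₀∪C₂ y
      InCₐ⇒∉C₀∪C₂ a<4 a≢0 a≢2 y∈Cₐ (inj₁ y∈C₀) = a≢0 (InC-unique 4∣n a<4 (s≤s z≤n) y∈Cₐ y∈C₀)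
      InCₐ⇒∉C₀∪C₂ a<4 a≢0 a≢2 y∈Cₐ (inj₂ y∈C₂) = a≢2 (InC-unique 4∣n a<4 (s≤s (s≤s (s≤s z≤n))) y∈Cₐ y∈C₂)

      InC₀∪C₂? : ∀ y → Dec (InC₀∪C₂ y)
      InC₀∪C₂? y with y ≟ 0#
      ... | yes refl = no λ { (inj₁ 0∈C₀) → InC-nonzero 0∈C₀ refl ; (inj₂ 0∈C₂) → InC-nonzero 0∈C₂ refl }
      ... | no  y≢0  with InC-classify y≢0
      ... | 0 , _   , y∈C₀ = yes (inj₁ y∈C₀)
      ... | 1 , a<4 , y∈C₁ = no (InCₐ⇒∉C₀∪C₂ a<4 (λ ()) (λ ()) y∈C₁)
      ... | 2 , _   , y∈C₂ = yes (inj₂ y∈C₂)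
      ... | 3 , a<4 , y∈C₃ = no (InCₐ⇒∉C₀∪C₂ a<4 (λ ()) (λ ()) y∈C₃)
      ... | suc (suc (suc (suc _))) , s≤s (s≤s (s≤s (s≤s ()))) , _

      InC₀∪C₂-neg : ∀ {y} → InC₀∪C₂ y → InC₀∪C₂ (- y)
      InC₀∪C₂-neg (inj₁ y∈C₀) = inj₁ (InC-neg 8∣n y∈C₀)
      InC₀∪C₂-neg (inj₂ y∈C₂) = inj₂ (InC-neg 8∣n y∈C₂)

      Complementary : Carrier → Carrier → Set
      Complementary c c′ = (InC α 4 0 c × InC α 4 2 c′) ⊎ (InC α 4 2 c × InC α 4 0 c′)

      module Blocks (γ : Carrier) (γ∈C₂ : InC α 4 2 γ) (R : List Carrier) (R-rep : IsRepSystem α R) where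

        R⊆C₀ : ∀ {r} → r ∈ R → InC α 4 0 r
        R⊆C₀ = All.lookup (proj₁ R-rep)

        R-covers : ∀ {x} → InC α 4 0 x → ∃ λ r → r ∈ R × x ≡± r
        R-covers = proj₁ (proj₂ R-rep) _

        R-distinct : ∀ i j → lookup R i ≡± lookup R j → i ≡ j
        R-distinct = proj₂ (proj₂ R-rep)

        𝒟 : List (List Carrier)
        𝒟 = map (blockD γ) R

        S : List Carrier
        S = concat 𝒟

        s : Carrier → ℕ
        s = multiplicity S

        T : Carrier → Carrier → ℕ
        T c g = ∑ R (λ r → ±δ (c * r) g)

        T≡1 : ∀ {c x g} → c ≢ 0# → InC α 4 0 x → c * x ≡ g → T c g ≡ 1
        T≡1 {c} {x} {g} c≢0 x∈C₀ cx≡g with R-covers x∈C₀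
        ... | r , r∈R , x≡±r = trans (∑-lookup-single R _ i others) (±δ-≡± 2#≢0 g≢0 cRᵢ≡±g)
          where
          i = index r∈R
          g≢0 : g ≢ 0#
          g≢0 = subst (_≢ 0#) cx≡g (*-nonzero c≢0 (InC-nonzero x∈C₀))
          Rᵢ≡±x : lookup R i ≡± x
          Rᵢ≡±x = subst (_≡± x) (lookup-index r∈R) (≡±-sym x≡±r)
          cRᵢ≡±g : c * lookup R i ≡± g
          cRᵢ≡±g = subst (c * lookup R i ≡±_) cx≡g (*-congˡ-≡± c Rᵢ≡±x)
          others : ∀ j → j ≢ i → ±δ (c * lookup R j) g ≡ 0
          others j j≢i = ±δ-≢± λ cRⱼ≡±g → j≢i (R-distinct j i (≡±-trans
            (*-cancelˡ-≡± c≢0 (subst (c * lookup R j ≡±_) (sym cx≡g) cRⱼ≡±g)) (≡±-sym Rᵢ≡±x)))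

        T≡0 : ∀ {b c g} → InC α 4 b c → ¬ InC α 4 b g → T c g ≡ 0
        T≡0 c∈C_b g∉C_b = ∑-zero-∈ R λ r∈R →
          ±δ-≢± λ cr≡±g → g∉C_b (InC-≡± (≡±-sym cr≡±g) (InC-*C₀ c∈C_b (R⊆C₀ r∈R)))

        T-same-class : ∀ {a c g} → InC α 4 a c → InC α 4 a g → T c g ≡ 1
        T-same-class c∈Cₐ g∈Cₐ with InC-quotient c∈Cₐ g∈Cₐ
        ... | x , x∈C₀ , cx≡g = T≡1 (InC-nonzero c∈Cₐ) x∈C₀ cx≡g

        T-pair-∈ : ∀ {c c′ g} → Complementary c c′ → InC₀∪C₂ g → T c g +ℕ T c′ g ≡ 1
        T-pair-∈ (inj₁ (c∈C₀ , c′∈C₂)) (inj₁ g∈C₀) =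
          cong₂ _+ℕ_ (T-same-class c∈C₀ g∈C₀) (T≡0 c′∈C₂ (C₀∩C₂≡∅ g∈C₀))
        T-pair-∈ (inj₁ (c∈C₀ , c′∈C₂)) (inj₂ g∈C₂) =
          cong₂ _+ℕ_ (T≡0 c∈C₀ (λ g∈C₀ → C₀∩C₂≡∅ g∈C₀ g∈C₂)) (T-same-class c′∈C₂ g∈C₂)
        T-pair-∈ (inj₂ (c∈C₂ , c′∈C₀)) (inj₁ g∈C₀) =
          cong₂ _+ℕ_ (T≡0 c∈C₂ (C₀∩C₂≡∅ g∈C₀)) (T-same-class c′∈C₀ g∈C₀)
        T-pair-∈ (inj₂ (c∈C₂ , c′∈C₀)) (inj₂ g∈C₂) =
          cong₂ _+ℕ_ (T-same-class c∈C₂ g∈C₂) (T≡0 c′∈C₀ (λ g∈C₀ → C₀∩C₂≡∅ g∈C₀ g∈C₂))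

        T-pair-∉ : ∀ {c c′ g} → Complementary c c′ → ¬ InC₀∪C₂ g → T c g +ℕ T c′ g ≡ 0
        T-pair-∉ (inj₁ (c∈C₀ , c′∈C₂)) g∉ = cong₂ _+ℕ_ (T≡0 c∈C₀ (g∉ ∘ inj₁)) (T≡0 c′∈C₂ (g∉ ∘ inj₂))
        T-pair-∉ (inj₂ (c∈C₂ , c′∈C₀)) g∉ = cong₂ _+ℕ_ (T≡0 c∈C₂ (g∉ ∘ inj₂)) (T≡0 c′∈C₀ (g∉ ∘ inj₁))

        T-complementary : ∀ {c c′ d d′} → Complementary c c′ → Complementary d d′ →
                          ∀ g → T c g +ℕ T c′ g ≡ T d g +ℕ T d′ g
        T-complementary cc′ dd′ g with InC₀∪C₂? g
        ... | yes g∈ = trans (T-pair-∈ cc′ g∈) (sym (T-pair-∈ dd′ g∈))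
        ... | no  g∉ = trans (T-pair-∉ cc′ g∉) (sym (T-pair-∉ dd′ g∉))

        1,γ-complementary : Complementary 1# γ
        1,γ-complementary = inj₁ ((0 , refl) , γ∈C₂)

        2,2γ-complementary : Complementary 2# (2# * γ)
        2,2γ-complementary = [ (λ 2∈C₀ → inj₁ (2∈C₀ , InC-* {0} {2} 2∈C₀ γ∈C₂))
                             , (λ 2∈C₂ → inj₂ (2∈C₂ , InC-reduce {0} (InC-* {2} {2} 2∈C₂ γ∈C₂))) ]′ 2-InC₀∪C₂

        s≡T1+Tγ : ∀ y → s y ≡ T 1# y +ℕ T γ y
        s≡T1+Tγ y = begin
          multiplicity (concat 𝒟) y                         ≡⟨ ∑-concat 𝒟 (λ z → δ z y) ⟩
          ∑ 𝒟 (λ D → multiplicity D y)                      ≡⟨ ∑-map (blockD γ) R (λ D → multiplicity D y) ⟩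
          ∑ R (λ r → multiplicity (blockD γ r) y)           ≡⟨ ∑-cong R (λ r → multiplicity-block r (γ * r) y) ⟩
          ∑ R (λ r → ±δ r y +ℕ ±δ (γ * r) y)                ≡⟨ ∑-distrib-+ R _ _ ⟩
          ∑ R (λ r → ±δ r y) +ℕ T γ y                       ≡⟨ cong (_+ℕ T γ y) (∑-cong R (λ r → cong (λ x → ±δ x y) (*-identityˡ r))) ⟨
          T 1# y +ℕ T γ y                                   ∎

        s-∈ : ∀ {y} → InC₀∪C₂ y → s y ≡ 1
        s-∈ {y} y∈ = trans (s≡T1+Tγ y) (T-pair-∈ 1,γ-complementary y∈)

        s-∉ : ∀ {y} → ¬ InC₀∪C₂ y → s y ≡ 0
        s-∉ {y} y∉ = trans (s≡T1+Tγ y) (T-pair-∉ 1,γ-complementary y∉)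

        s-neg : ∀ y → s (- y) ≡ s y
        s-neg y with InC₀∪C₂? y
        ... | yes y∈ = trans (s-∈ (InC₀∪C₂-neg y∈)) (sym (s-∈ y∈))
        ... | no  y∉ = trans (s-∉ (y∉ ∘ subst InC₀∪C₂ (-‿involutive y) ∘ InC₀∪C₂-neg)) (sym (s-∉ y∉))

        block-classes : ∀ {r x} → InC α 4 0 r → x ∈ blockD γ r →
                        (InC α 4 0 x × x ≡± r) ⊎ (InC α 4 2 x × x ≡± γ * r)
        block-classes r∈C₀ (here x≡r)                           = inj₁ (InC-≡± (inj₁ x≡r) r∈C₀ , inj₁ x≡r)
        block-classes r∈C₀ (there (here x≡-r))                  = inj₁ (InC-≡± (inj₂ x≡-r) r∈C₀ , inj₂ x≡-r)
        block-classes r∈C₀ (there (there (here x≡γr)))          = inj₂ (InC-≡± (inj₁ x≡γr) (InC-*C₀ γ∈C₂ r∈C₀) , inj₁ x≡γr)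
        block-classes r∈C₀ (there (there (there (here x≡-γr)))) = inj₂ (InC-≡± (inj₂ x≡-γr) (InC-*C₀ γ∈C₂ r∈C₀) , inj₂ x≡-γr)

        S⊆C₀∪C₂ : ∀ {y} → y ∈ S → InC₀∪C₂ y
        S⊆C₀∪C₂ y∈S with ∈-concat⁻′ 𝒟 y∈S
        ... | D , y∈D , D∈𝒟 with ∈-map⁻ (blockD γ) D∈𝒟
        ... | r , r∈R , refl with block-classes (R⊆C₀ r∈R) y∈D
        ... | inj₁ (y∈C₀ , _) = inj₁ y∈C₀
        ... | inj₂ (y∈C₂ , _) = inj₂ y∈C₂

        blocks-overlap : ∀ {r r′ x} → InC α 4 0 r → InC α 4 0 r′ → x ∈ blockD γ r → x ∈ blockD γ r′ → r ≡± r′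
        blocks-overlap r∈C₀ r′∈C₀ x∈ x∈′ with block-classes r∈C₀ x∈ | block-classes r′∈C₀ x∈′
        ... | inj₁ (_ , x≡±r)     | inj₁ (_ , x≡±r′)     = ≡±-trans (≡±-sym x≡±r) x≡±r′
        ... | inj₁ (x∈C₀ , _)     | inj₂ (x∈C₂ , _)      = ⊥-elim (C₀∩C₂≡∅ x∈C₀ x∈C₂)
        ... | inj₂ (x∈C₂ , _)     | inj₁ (x∈C₀ , _)      = ⊥-elim (C₀∩C₂≡∅ x∈C₀ x∈C₂)
        ... | inj₂ (_ , x≡±γr)    | inj₂ (_ , x≡±γr′)    = *-cancelˡ-≡± (InC-nonzero γ∈C₂) (≡±-trans (≡±-sym x≡±γr) x≡±γr′)

        block-Unique : ∀ {r} → InC α 4 0 r → Unique (blockD γ r)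
        block-Unique {r} r∈C₀ = (r≢-r ∷ C₀≢C₂ r∈C₀ γr∈C₂ ∷ C₀≢C₂ r∈C₀ -γr∈C₂ ∷ [])
                              ∷ (C₀≢C₂ -r∈C₀ γr∈C₂ ∷ C₀≢C₂ -r∈C₀ -γr∈C₂ ∷ [])
                              ∷ (γr≢-γr ∷ [])
                              ∷ [] ∷ []
          where
          -r∈C₀ = InC-neg 8∣n r∈C₀
          γr∈C₂ = InC-*C₀ γ∈C₂ r∈C₀
          -γr∈C₂ = InC-neg 8∣n γr∈C₂
          r≢-r = x≢-x 2#≢0 (InC-nonzero r∈C₀)
          γr≢-γr = x≢-x 2#≢0 (InC-nonzero γr∈C₂)

        block-nonzero : ∀ {r} → InC α 4 0 r → All.All (_≢ 0#) (blockD γ r)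
        block-nonzero {r} r∈C₀ = All.tabulate λ x∈ → [ InC-nonzero ∘ proj₁ , InC-nonzero ∘ proj₁ ]′ (block-classes r∈C₀ x∈)

        𝒟-disjoint : ∀ (i j : Fin (length 𝒟)) → i ≢ j → ∀ x → x ∈ lookup 𝒟 i → x ∉ lookup 𝒟 j
        𝒟-disjoint i j i≢j x x∈𝒟ᵢ x∈𝒟ⱼ = i≢j (Fin.toℕ-injective (begin
          toℕ i      ≡⟨ Fin.toℕ-cast _ i ⟨
          toℕ (ι i)  ≡⟨ cong toℕ (R-distinct (ι i) (ι j) Rᵢ≡±Rⱼ) ⟩
          toℕ (ι j)  ≡⟨ Fin.toℕ-cast _ j ⟩
          toℕ j      ∎))
          where
          ι : Fin (length 𝒟) → Fin (length R)
          ι = Fin.cast (length-map (blockD γ) R)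
          Rᵢ≡±Rⱼ : lookup R (ι i) ≡± lookup R (ι j)
          Rᵢ≡±Rⱼ = blocks-overlap (R⊆C₀ (∈-lookup (ι i))) (R⊆C₀ (∈-lookup (ι j)))
                                  (subst (x ∈_) (lookup-map (blockD γ) R i) x∈𝒟ᵢ)
                                  (subst (x ∈_) (lookup-map (blockD γ) R j) x∈𝒟ⱼ)

        square-roots-count : ∀ y → ∑ elements (λ b → δ≢ b 0# *ℕ δ (b * b) y) ≡ 2 *ℕ s y
        square-roots-count y with InC₀∪C₂? y
        ... | no y∉ = trans (∑-zero elements no-root) (cong (2 *ℕ_) (sym (s-∉ y∉)))
          where
          no-root : ∀ b → δ≢ b 0# *ℕ δ (b * b) y ≡ 0
          no-root b with b ≟ 0#
          ... | yes _   = refl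
          ... | no  b≢0 = trans (ℕ.+-identityʳ _) (δ-≢ (λ b²≡y → y∉ (subst InC₀∪C₂ b²≡y (square-InC₀∪C₂ b≢0))))
        ... | yes y∈ with InC₀∪C₂-square y∈
        ... | b₀ , b₀≢0 , b₀²≡y = begin
          ∑ elements (λ b → δ≢ b 0# *ℕ δ (b * b) y)       ≡⟨ ∑-cong elements roots ⟩
          ∑ elements (λ b → δ b b₀ +ℕ δ b (- b₀))         ≡⟨ ∑-distrib-+ elements _ _ ⟩
          ∑ elements (λ b → δ b b₀) +ℕ ∑ elements (λ b → δ b (- b₀))
                                                          ≡⟨ cong₂ _+ℕ_ (∑-δ≡1 b₀) (∑-δ≡1 (- b₀)) ⟩
          2                                               ≡⟨ cong (2 *ℕ_) (s-∈ y∈) ⟨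
          2 *ℕ s y                                        ∎
          where
          roots : ∀ b → δ≢ b 0# *ℕ δ (b * b) y ≡ δ b b₀ +ℕ δ b (- b₀)
          roots b = trans (root-indicator b) (cong₂ _+ℕ_ (δ-sym b₀ b) (δ-sym (- b₀) b))
            where
            root-indicator : ∀ b → δ≢ b 0# *ℕ δ (b * b) y ≡ ±δ b₀ b
            root-indicator b with b ≟ 0#
            ... | yes refl = sym (±δ-≢± λ { (inj₁ b₀≡0) → b₀≢0 b₀≡0 ; (inj₂ b₀≡-0) → b₀≢0 (trans b₀≡-0 -0#≈0#) })
            ... | no  b≢0  = trans (ℕ.+-identityʳ _) (case (b * b) ≟ y of λ where
                (yes b²≡y) → trans (δ-≡ b²≡y) (sym (±δ-≡± 2#≢0 b≢0 (≡±-sym (square-roots (trans b²≡y (sym b₀²≡y))))))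
                (no  b²≢y) → trans (δ-≢ b²≢y) (sym (±δ-≢± (λ b₀≡±b → b²≢y (trans (sym (≡±⇒x²≡y² b₀≡±b)) b₀²≡y)))))

        ∑-squares : ∀ h → ∑ elements (λ b → δ≢ b 0# *ℕ h (b * b)) ≡ 2 *ℕ ∑ elements (λ y → s y *ℕ h y)
        ∑-squares h = begin
          ∑ elements (λ b → δ≢ b 0# *ℕ h (b * b))       ≡⟨ ∑-pushforward (λ b → δ≢ b 0#) (λ b → b * b) h ⟩
          ∑ elements (λ y → ∑ elements (λ b → δ≢ b 0# *ℕ δ (b * b) y) *ℕ h y)
                                                        ≡⟨ ∑-cong elements (λ y → cong (_*ℕ h y) (square-roots-count y)) ⟩
          ∑ elements (λ y → 2 *ℕ s y *ℕ h y)            ≡⟨ ∑-cong elements (λ y → ℕ.*-assoc 2 (s y) (h y)) ⟩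
          ∑ elements (λ y → 2 *ℕ (s y *ℕ h y))          ≡⟨ ∑-*ˡ elements 2 _ ⟩
          2 *ℕ ∑ elements (λ y → s y *ℕ h y)            ∎

        n≡|R|*8 : n ≡ length R *ℕ 8
        n≡|R|*8 = begin
          n                                        ≡⟨ ∑-nonzero ⟨
          ∑ elements (λ b → δ≢ b 0#)               ≡⟨ ∑-cong elements (λ b → ℕ.*-identityʳ _) ⟨
          ∑ elements (λ b → δ≢ b 0# *ℕ 1)          ≡⟨ ∑-squares (λ _ → 1) ⟩
          2 *ℕ ∑ elements (λ y → s y *ℕ 1)         ≡⟨ cong (2 *ℕ_) (∑-via-multiplicity S (λ _ → 1)) ⟨
          2 *ℕ ∑ S (λ _ → 1)                       ≡⟨ cong (2 *ℕ_) (∑-concat 𝒟 (λ _ → 1)) ⟩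
          2 *ℕ ∑ 𝒟 (λ D → ∑ D (λ _ → 1))           ≡⟨ cong (2 *ℕ_) (∑-map (blockD γ) R (λ D → ∑ D (λ _ → 1))) ⟩
          2 *ℕ ∑ R (λ _ → 4)                       ≡⟨ cong (2 *ℕ_) (∑-const R 4) ⟩
          2 *ℕ (length R *ℕ 4)                     ≡⟨ regroup (length R) ⟩
          length R *ℕ 8                            ∎
          where
          regroup : ∀ m → 2 *ℕ (m *ℕ 4) ≡ m *ℕ 8
          regroup = solve-∀

        multΔ₂-S : ∀ g → multΔ₂ S S g ≡ ∑ elements (λ x → s x *ℕ ∑ elements (λ y → s y *ℕ δ (x - y) g))
        multΔ₂-S g = trans (∑-via-multiplicity S (λ x → ∑ S (λ y → δ (x - y) g)))
                           (∑-cong elements (λ x → cong (s x *ℕ_) (∑-via-multiplicity S (λ y → δ (x - y) g))))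

        pairs-a≡0 : ∀ {g} → g ≢ 0# → ∑ elements (λ a → ∑ elements (λ b → δ a 0# *ℕ δ (a * a - b * b) g)) ≡ 2 *ℕ s g
        pairs-a≡0 {g} g≢0 = begin
          ∑ elements (λ a → ∑ elements (λ b → δ a 0# *ℕ δ (a * a - b * b) g))
            ≡⟨ ∑-cong elements (λ a → ∑-*ˡ elements (δ a 0#) _) ⟩
          ∑ elements (λ a → δ a 0# *ℕ ∑ elements (λ b → δ (a * a - b * b) g))
            ≡⟨ ∑-select′ 0# (λ a → ∑ elements (λ b → δ (a * a - b * b) g)) ⟩
          ∑ elements (λ b → δ (0# * 0# - b * b) g)
            ≡⟨ ∑-cong elements (λ b → δ-cong 0²-b²≡g⇒b²≡-g b²≡-g⇒0²-b²≡g) ⟩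
          ∑ elements (λ b → δ (b * b) (- g))
            ≡⟨ ∑-cong elements (δ-square-nonzero (g≢0 ∘ -‿injective ∘ flip trans (sym -0#≈0#))) ⟩
          ∑ elements (λ b → δ≢ b 0# *ℕ δ (b * b) (- g))
            ≡⟨ square-roots-count (- g) ⟩
          2 *ℕ s (- g)
            ≡⟨ cong (2 *ℕ_) (s-neg g) ⟩
          2 *ℕ s g ∎
          where
          0²-b²≡-b² : ∀ b → 0# * 0# - b * b ≡ - (b * b)
          0²-b²≡-b² b = trans (cong (_- b * b) (zeroˡ 0#)) (+-identityˡ _)
          0²-b²≡g⇒b²≡-g : ∀ {b} → 0# * 0# - b * b ≡ g → b * b ≡ - g
          0²-b²≡g⇒b²≡-g {b} eq = trans (sym (-‿involutive (b * b))) (cong -_ (trans (sym (0²-b²≡-b² b)) eq))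
          b²≡-g⇒0²-b²≡g : ∀ {b} → b * b ≡ - g → 0# * 0# - b * b ≡ g
          b²≡-g⇒0²-b²≡g {b} eq = trans (0²-b²≡-b² b) (trans (cong -_ eq) (-‿involutive g))

        pairs-b≡0 : ∀ g → ∑ elements (λ a → ∑ elements (λ b → δ≢ a 0# *ℕ (δ b 0# *ℕ δ (a * a - b * b) g))) ≡ 2 *ℕ s g
        pairs-b≡0 g = begin
          ∑ elements (λ a → ∑ elements (λ b → δ≢ a 0# *ℕ (δ b 0# *ℕ δ (a * a - b * b) g)))
            ≡⟨ ∑-cong elements (λ a → ∑-*ˡ elements (δ≢ a 0#) _) ⟩
          ∑ elements (λ a → δ≢ a 0# *ℕ ∑ elements (λ b → δ b 0# *ℕ δ (a * a - b * b) g))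
            ≡⟨ ∑-cong elements (λ a → cong (δ≢ a 0# *ℕ_) (∑-select′ 0# (λ b → δ (a * a - b * b) g))) ⟩
          ∑ elements (λ a → δ≢ a 0# *ℕ δ (a * a - 0# * 0#) g)
            ≡⟨ ∑-cong elements (λ a → cong (λ x → δ≢ a 0# *ℕ δ x g) (a²-0²≡a² a)) ⟩
          ∑ elements (λ a → δ≢ a 0# *ℕ δ (a * a) g)
            ≡⟨ square-roots-count g ⟩
          2 *ℕ s g ∎
          where
          a²-0²≡a² : ∀ a → a * a - 0# * 0# ≡ a * a
          a²-0²≡a² a = trans (cong (λ x → a * a + - x) (zeroˡ 0#)) (trans (cong (a * a +_) -0#≈0#) (+-identityʳ _))

        pairs-a,b≢0 : ∀ g → ∑ elements (λ a → ∑ elements (λ b → δ≢ a 0# *ℕ (δ≢ b 0# *ℕ δ (a * a - b * b) g)))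
                            ≡ 4 *ℕ multΔ₂ S S g
        pairs-a,b≢0 g = begin
          ∑ elements (λ a → ∑ elements (λ b → δ≢ a 0# *ℕ (δ≢ b 0# *ℕ δ (a * a - b * b) g)))
            ≡⟨ ∑-cong elements (λ a → ∑-*ˡ elements (δ≢ a 0#) _) ⟩
          ∑ elements (λ a → δ≢ a 0# *ℕ ∑ elements (λ b → δ≢ b 0# *ℕ δ (a * a - b * b) g))
            ≡⟨ ∑-cong elements (λ a → cong (δ≢ a 0# *ℕ_) (∑-squares (λ y → δ (a * a - y) g))) ⟩
          ∑ elements (λ a → δ≢ a 0# *ℕ (2 *ℕ H (a * a)))
            ≡⟨ ∑-cong elements (λ a → ℕ.*-comm (δ≢ a 0#) _) ⟩
          ∑ elements (λ a → 2 *ℕ H (a * a) *ℕ δ≢ a 0#)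
            ≡⟨ ∑-cong elements (λ a → trans (ℕ.*-assoc 2 (H (a * a)) _) (cong (2 *ℕ_) (ℕ.*-comm (H (a * a)) _))) ⟩
          ∑ elements (λ a → 2 *ℕ (δ≢ a 0# *ℕ H (a * a)))
            ≡⟨ ∑-*ˡ elements 2 _ ⟩
          2 *ℕ ∑ elements (λ a → δ≢ a 0# *ℕ H (a * a))
            ≡⟨ cong (2 *ℕ_) (∑-squares H) ⟩
          2 *ℕ (2 *ℕ ∑ elements (λ x → s x *ℕ H x))
            ≡⟨ cong (λ m → 2 *ℕ (2 *ℕ m)) (multΔ₂-S g) ⟨
          2 *ℕ (2 *ℕ multΔ₂ S S g)
            ≡⟨ ℕ.*-assoc 2 2 (multΔ₂ S S g) ⟨
          4 *ℕ multΔ₂ S S g ∎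
          where
          H : Carrier → ℕ
          H v = ∑ elements (λ y → s y *ℕ δ (v - y) g)

        n≡4M+4s : ∀ {g} → g ≢ 0# → n ≡ 4 *ℕ multΔ₂ S S g +ℕ 4 *ℕ s g
        n≡4M+4s {g} g≢0 = begin
          n                                                            ≡⟨ ∑-difference-of-squares 2#≢0 g≢0 ⟨
          ∑∑ t                                                         ≡⟨ ∑-cong elements (λ a → ∑-cong elements (λ b → δ-partition a b (t a b))) ⟩
          ∑∑ (λ a b → P₀ a b +ℕ (P₁ a b +ℕ P₂ a b))                    ≡⟨ ∑∑-distrib ⟩
          ∑∑ P₀ +ℕ (∑∑ P₁ +ℕ ∑∑ P₂)                                    ≡⟨ cong₂ _+ℕ_ (pairs-a≡0 g≢0) (cong₂ _+ℕ_ (pairs-b≡0 g) (pairs-a,b≢0 g)) ⟩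
          2 *ℕ s g +ℕ (2 *ℕ s g +ℕ 4 *ℕ multΔ₂ S S g)                 ≡⟨ regroup (s g) (multΔ₂ S S g) ⟩
          4 *ℕ multΔ₂ S S g +ℕ 4 *ℕ s g                                ∎
          where
          ∑∑ : (Carrier → Carrier → ℕ) → ℕ
          ∑∑ f = ∑ elements (λ a → ∑ elements (f a))

          t P₀ P₁ P₂ : Carrier → Carrier → ℕ
          t a b  = δ (a * a - b * b) g
          P₀ a b = δ a 0# *ℕ t a b
          P₁ a b = δ≢ a 0# *ℕ (δ b 0# *ℕ t a b)
          P₂ a b = δ≢ a 0# *ℕ (δ≢ b 0# *ℕ t a b)

          ∑∑-distrib : ∑∑ (λ a b → P₀ a b +ℕ (P₁ a b +ℕ P₂ a b)) ≡ ∑∑ P₀ +ℕ (∑∑ P₁ +ℕ ∑∑ P₂)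
          ∑∑-distrib = begin
            ∑ elements (λ a → ∑ elements (λ b → P₀ a b +ℕ (P₁ a b +ℕ P₂ a b)))
              ≡⟨ ∑-cong elements (λ a → trans (∑-distrib-+ elements _ _) (cong (∑ elements (P₀ a) +ℕ_) (∑-distrib-+ elements _ _))) ⟩
            ∑ elements (λ a → ∑ elements (P₀ a) +ℕ (∑ elements (P₁ a) +ℕ ∑ elements (P₂ a)))
              ≡⟨ trans (∑-distrib-+ elements _ _) (cong (∑∑ P₀ +ℕ_) (∑-distrib-+ elements _ _)) ⟩
            ∑∑ P₀ +ℕ (∑∑ P₁ +ℕ ∑∑ P₂) ∎

          regroup : ∀ x m → 2 *ℕ x +ℕ (2 *ℕ x +ℕ 4 *ℕ m) ≡ 4 *ℕ m +ℕ 4 *ℕ x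
          regroup = solve-∀

        multDPDF≡3s : Complementary (1# - γ) (1# + γ) → ∀ {g} → g ≢ 0# → multDPDF 𝒟 g ≡ 3 *ℕ s g
        multDPDF≡3s 1∓γ {g} g≢0 = begin
          multDPDF 𝒟 g
            ≡⟨ ∑-map (blockD γ) R (λ D → multΔ D g) ⟩
          ∑ R (λ r → multΔ (blockD γ r) g)
            ≡⟨ ∑-cong R (λ r → trans (multΔ≡multΔ₂ g≢0 (blockD γ r)) (Δ-block g≢0 r (γ * r))) ⟩
          ∑ R (λ r → ±δ (r + r) g +ℕ ±δ (γ * r + γ * r) g +ℕ 2 *ℕ (±δ (r - γ * r) g +ℕ ±δ (r + γ * r) g))
            ≡⟨ ∑-cong R (λ r → cong₂ (λ x y → x +ℕ 2 *ℕ y)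
                                 (cong₂ _+ℕ_ (at (x+x≡2x r)) (at (trans (x+x≡2x (γ * r)) (sym (*-assoc 2# γ r)))))
                                 (cong₂ _+ℕ_ (at (sym [1-γ]r≡r-γr)) (at (sym [1+γ]r≡r+γr)))) ⟩
          ∑ R (λ r → ±δ (2# * r) g +ℕ ±δ (2# * γ * r) g +ℕ 2 *ℕ (±δ ((1# - γ) * r) g +ℕ ±δ ((1# + γ) * r) g))
            ≡⟨ trans (∑-distrib-+ R _ _) (cong₂ _+ℕ_ (∑-distrib-+ R _ _)
                 (trans (∑-*ˡ R 2 _) (cong (2 *ℕ_) (∑-distrib-+ R _ _)))) ⟩
          T 2# g +ℕ T (2# * γ) g +ℕ 2 *ℕ (T (1# - γ) g +ℕ T (1# + γ) g)
            ≡⟨ cong₂ (λ x y → x +ℕ 2 *ℕ y) (T-complementary 2,2γ-complementary 1,γ-complementary g)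
                                           (T-complementary 1∓γ 1,γ-complementary g) ⟩
          T 1# g +ℕ T γ g +ℕ 2 *ℕ (T 1# g +ℕ T γ g)
            ≡⟨ cong (λ x → x +ℕ 2 *ℕ x) (s≡T1+Tγ g) ⟨
          s g +ℕ 2 *ℕ s g
            ≡⟨ triple (s g) ⟩
          3 *ℕ s g ∎
          where
          at : ∀ {x y} → x ≡ y → ±δ x g ≡ ±δ y g
          at = cong (λ z → ±δ z g)
          [1-γ]r≡r-γr : ∀ {r} → (1# - γ) * r ≡ r - γ * r
          [1-γ]r≡r-γr {r} = trans (distribʳ r 1# (- γ)) (cong₂ _+_ (*-identityˡ r) (sym (-‿distribˡ-* γ r)))
          [1+γ]r≡r+γr : ∀ {r} → (1# + γ) * r ≡ r + γ * r
          [1+γ]r≡r+γr {r} = trans (distribʳ r 1# γ) (cong (_+ γ * r) (*-identityˡ r))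
          triple : ∀ x → x +ℕ 2 *ℕ x ≡ 3 *ℕ x
          triple = solve-∀

        𝒟-isCollection : IsCollection size (n / 8) 4 𝒟
        𝒟-isCollection = refl , |𝒟|≡n/8 , AllP.map⁺ (All.tabulate blocks) , 𝒟-disjoint
          where
          |𝒟|≡n/8 : length 𝒟 ≡ n / 8
          |𝒟|≡n/8 = trans (length-map (blockD γ) R) (sym (trans (cong (_/ 8) n≡|R|*8) (m*n/n≡m (length R) 8)))
          blocks : ∀ {r} → r ∈ R → Unique (blockD γ r) × length (blockD γ r) ≡ 4 × All.All (_≢ 0#) (blockD γ r)
          blocks r∈R = block-Unique (R⊆C₀ r∈R) , refl , block-nonzero (R⊆C₀ r∈R)

        𝒟-isDPDF : Complementary (1# - γ) (1# + γ) → IsDPDF size (n / 8) 4 (ℤ.+ 3) (ℤ.+ 0) 𝒟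
        𝒟-isDPDF 1∓γ = 𝒟-isCollection , λ g →
            (λ { refl → ∑-zero 𝒟 multΔ-0 })
          , (λ g≢0 g∈S → cong ℤ.+_ (trans (multDPDF≡3s 1∓γ g≢0) (cong (3 *ℕ_) (s-∈ (S⊆C₀∪C₂ g∈S)))))
          , (λ g≢0 g∉S → cong ℤ.+_ (trans (multDPDF≡3s 1∓γ g≢0) (cong (3 *ℕ_) (multiplicity-∉ g∉S))))

        size≡4E+1+16s : Complementary (1# - γ) (1# + γ) → ∀ {g} → g ≢ 0# →
                        size ≡ multEPDF 𝒟 g *ℕ 4 +ℕ (1 +ℕ 16 *ℕ s g)
        size≡4E+1+16s 1∓γ {g} g≢0 = solve-for-E {multEPDF 𝒟 g} {s g} E+3s≡M (n≡4M+4s g≢0) size≡1+n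
          where
          E+3s≡M : multEPDF 𝒟 g +ℕ 3 *ℕ s g ≡ multΔ₂ S S g
          E+3s≡M = begin
            multEPDF 𝒟 g +ℕ 3 *ℕ s g                 ≡⟨ cong (multEPDF 𝒟 g +ℕ_) (multDPDF≡3s 1∓γ g≢0) ⟨
            multEPDF 𝒟 g +ℕ multDPDF 𝒟 g             ≡⟨ cong (multEPDF 𝒟 g +ℕ_) (∑-cong 𝒟 (multΔ≡multΔ₂ g≢0)) ⟩
            multEPDF 𝒟 g +ℕ ∑ 𝒟 (λ D → multΔ₂ D D g) ≡⟨ multEPDF+diagonal 𝒟 g ⟩
            multΔ₂ S S g                             ∎
          solve-for-E : ∀ {E σ M m q} → E +ℕ 3 *ℕ σ ≡ M → m ≡ 4 *ℕ M +ℕ 4 *ℕ σ → q ≡ suc m → q ≡ E *ℕ 4 +ℕ (1 +ℕ 16 *ℕ σ)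
          solve-for-E {E} {σ} refl refl refl = arithmetic E σ
            where
            arithmetic : ∀ E σ → suc (4 *ℕ (E +ℕ 3 *ℕ σ) +ℕ 4 *ℕ σ) ≡ E *ℕ 4 +ℕ (1 +ℕ 16 *ℕ σ)
            arithmetic = solve-∀

        𝒟-isEPDF : Complementary (1# - γ) (1# + γ) →
                   IsEPDF size (n / 8) 4 ((ℤ.+ size ℤ.- ℤ.+ 17) ℤ./ℕ 4) ((ℤ.+ size ℤ.- ℤ.+ 1) ℤ./ℕ 4) 𝒟
        𝒟-isEPDF 1∓γ = 𝒟-isCollection , λ g →
            (λ { refl → multEPDF-0 𝒟 𝒟-disjoint })
          , (λ g≢0 g∈S → sym ([m-c]/d≡e (subst (λ σ → size ≡ multEPDF 𝒟 g *ℕ 4 +ℕ (1 +ℕ 16 *ℕ σ)) (s-∈ (S⊆C₀∪C₂ g∈S))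
                                                (size≡4E+1+16s 1∓γ g≢0))))
          , (λ g≢0 g∉S → sym ([m-c]/d≡e (subst (λ σ → size ≡ multEPDF 𝒟 g *ℕ 4 +ℕ (1 +ℕ 16 *ℕ σ)) (multiplicity-∉ g∉S)
                                                (size≡4E+1+16s 1∓γ g≢0))))

open import Data.Nat using (ℕ; _∸_; _/_; _%_)
open import Data.Integer using (+_; _/ℕ_) renaming (_-_ to _-ℤ_)
open import Data.List using (List; map)
open import Data.Product using (_×_; _,_)
open import Data.Sum using (_⊎_)
open import Relation.Binary.PropositionalEquality using (_≡_)

mainTheorem19 : (F : FiniteField) → let open FiniteField F in
    IsPrimePower size → size % 8 ≡ 1 →
    (α : Carrier) → IsPrimitive α →
    (γ : Carrier) → InC α 4 2 γ →
    (R : List Carrier) → IsRepSystem α R →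
    ((InC α 4 0 (1# - γ) × InC α 4 2 (1# + γ)) ⊎ (InC α 4 2 (1# - γ) × InC α 4 0 (1# + γ))) →
    IsEPDF size ((size ∸ 1) / 8) 4 ((+ size -ℤ + 17) /ℕ 4) ((+ size -ℤ + 1) /ℕ 4) (map (blockD γ) R)
      × IsDPDF size ((size ∸ 1) / 8) 4 (+ 3) (+ 0) (map (blockD γ) R)
mainTheorem19 F _ size%8≡1 α α-primitive γ γ∈C₂ R R-rep 1∓γ = 𝒟-isEPDF 1∓γ , 𝒟-isDPDF 1∓γ
  where
  open FieldTheory F
  open Primitive α α-primitive
  open Quartic (size%d≡1⇒d∣n 8 size%8≡1)
  open Blocks γ γ∈C₂ R R-rep
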